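{- Let $F$ be a set of skew-decomposable separable permutations and let $\mathcal X=\mathrm{Av}_S(F)$. Then $\mathrm{Av}(213)[\mathcal X]=\mathrm{Av}_S(F\oplus 1)$, where $F\oplus1=\{\pi\oplus1:\pi\in F\}$.
   Context: $\mathrm{Av}_S(F)$ is the set of separable permutations (elements of $\mathrm{Av}(2413,3142)$) avoiding every element of $F$. $\oplus$ is the direct sum of permutations. For classes, $\mathcal C[\mathcal E]$ is the set of inflations $\sigma[\tau_1,\dots,\tau_k]$ with $\sigma\in\mathcal C$ of size $k$ and $\tau_i\in\mathcal E$ (each point $\sigma_i$ replaced by an interval order-isomorphic to $\tau_i$). -}

module Defs where

open import Data.Nat using (ℕ; zero; suc; _+_; _<ᵇ_; _<?_)
open import Data.Bool using (if_then_else_)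
open import Data.List using (List; []; _∷_; _++_; map; length; filter; upTo; concat; zipWith)
open import Data.Nat.ListAction using (sum)
open import Data.List.Relation.Binary.Permutation.Propositional using (_↭_)
open import Data.List.Relation.Binary.Sublist.Propositional using (_⊆_)
open import Data.List.Relation.Unary.All using (All)
open import Data.Product using (Σ; ∃; _×_)
open import Relation.Binary.PropositionalEquality using (_≡_)
open import Relation.Nullary using (¬_)

-- A permutation of size n is a list in one-line notation which is a
-- rearrangement of 0,1,…,n-1 (entries 0-indexed).
IsPerm : List ℕ → Set
IsPerm xs = xs ↭ upTo (length xs)

rank : ℕ → List ℕ → ℕ
rank x xs = length (filter (_<? x) xs)

std : List ℕ → List ℕ
std xs = map (λ x → rank x xs) xs

Contains : List ℕ → List ℕ → Set
Contains π σ = Σ (List ℕ) (λ ys → (ys ⊆ π) × (std ys ≡ σ))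

Avoids : List ℕ → List ℕ → Set
Avoids π σ = ¬ Contains π σ

_⊕_ : List ℕ → List ℕ → List ℕ
α ⊕ β = α ++ map (length α +_) β

_⊖_ : List ℕ → List ℕ → List ℕ
α ⊖ β = map (_+ length β) α ++ β

NonEmpty : List ℕ → Set
NonEmpty xs = Σ ℕ (λ y → Σ (List ℕ) (λ ys → xs ≡ y ∷ ys))

SkewDecomposable : List ℕ → Set
SkewDecomposable π =
  Σ (List ℕ) (λ α → Σ (List ℕ) (λ β →
    IsPerm α × IsPerm β × NonEmpty α × NonEmpty β × (π ≡ α ⊖ β)))

-- separable permutations: Av(2413, 3142)  (0-indexed patterns)
Separable : List ℕ → Set
Separable π = IsPerm π × Avoids π (1 ∷ 3 ∷ 0 ∷ 2 ∷ []) × Avoids π (2 ∷ 0 ∷ 3 ∷ 1 ∷ [])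

AvS : (List ℕ → Set) → List ℕ → Set
AvS F π = Separable π × (∀ σ → F σ → Avoids π σ)

Av213 : List ℕ → Set
Av213 π = IsPerm π × Avoids π (1 ∷ 0 ∷ 2 ∷ [])

_⊕1 : (List ℕ → Set) → List ℕ → Set
(F ⊕1) ρ = Σ (List ℕ) (λ σ → F σ × (ρ ≡ σ ⊕ (0 ∷ [])))

-- inflation σ[τ₁,…,τₖ]: block i is τᵢ shifted by the total size of the
-- τⱼ with σⱼ < σᵢ; blocks are concatenated in position order.
inflate : List ℕ → List (List ℕ) → List ℕ
inflate σ τs = concat (zipWith (λ s τ → map (offset s +_) τ) σ τs)
  where
  offset : ℕ → ℕ
  offset s = sum (zipWith (λ s' τ' → if s' <ᵇ s then length τ' else 0) σ τs)

Inflations : (List ℕ → Set) → (List ℕ → Set) → List ℕ → Set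
Inflations C E π =
  Σ (List ℕ) (λ σ → Σ (List (List ℕ)) (λ τs →
    C σ × (length τs ≡ length σ) × All E τs × (π ≡ inflate σ τs)))

-- A nonempty 213-avoider is (1 ⊕ γ) ⊖ δ with γ, δ avoiding 213, and a separable permutation
-- of size at least 2 is α ⊕ β or α ⊖ β with α, β nonempty (remove the maximum, decompose the
-- rest and reinsert it: every failure exhibits a 2413 or a 3142).  Both inclusions follow by
-- induction along these decompositions, using two facts about g ⊕ 1 for skew-decomposable g.
-- It ends with its maximum, so it is skew-indecomposable and occurs in α ⊖ β only inside α or
-- inside β.  Since g is sum-indecomposable, an occurrence in α ⊕ β either lies in β or meets α
-- in a pattern containing g.  Hence (1 ⊕ γ) ⊖ δ inflated by τ ∈ Av_S(F) and by blocks in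
-- Av_S(F ⊕ 1) lies in Av_S(F ⊕ 1); conversely, in a sum decomposition α ⊕ β of an element of
-- Av_S(F ⊕ 1) the summand α avoids F, as α together with a point of β would contain g ⊕ 1.

module Submission where

open import Defs
open import Data.Nat using (ℕ)
open import Data.List using (List)
open import Data.Product using (_×_)

open import Data.Nat using (zero; suc; _+_; _∸_; _≤_; _<_; _≮_; z≤n; s≤s; z<s; _<?_; _≤?_; _<ᵇ_; _≟_)
open import Data.Nat.Properties
open import Data.Bool using (true; false; if_then_else_)
open import Data.List using ([]; _∷_; _++_; map; length; filter; upTo; take; drop; applyUpTo; concat; zipWith; initLast; _∷ʳ′_)
open import Data.List.Properties
  using (length-map; length-++; length-upTo; length-filter; length-++-sucʳ; upTo-∷ʳ; map-upTo;
         map-++; map-∘; map-cong; map-cong-local; map-id; filter-accept; filter-reject; filter-all; filter-none;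
         filter-++; ++-assoc; ++-identityʳ; ∷-injective; ∷ʳ-injective; ∷ʳ-injectiveˡ)
open import Data.Nat.ListAction using (sum)
open import Data.List.Membership.Propositional using (_∈_; find)
open import Data.List.Membership.Propositional.Properties
  using (∈-++⁺ˡ; ∈-++⁺ʳ; ∈-∃++; ∈-upTo⁻; ∈-applyUpTo⁺)
open import Data.List.Membership.DecPropositional _≟_ using (_∈?_)
open import Data.List.Relation.Unary.All as All using (All; []; _∷_)
open import Data.List.Relation.Unary.All.Properties as All using (¬All⇒Any¬)
open import Data.List.Relation.Unary.Any using (here; there)
open import Data.List.Relation.Unary.Unique.Propositional using (Unique)
open import Data.List.Relation.Unary.Unique.Propositional.Properties using (upTo⁺)
open import Data.List.Relation.Unary.AllPairs using ([]; _∷_)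
open import Data.List.Relation.Binary.Sublist.Propositional using (_⊆_; []; _∷_; _∷ʳ_; ⊆-refl; ⊆-trans; minimum; from∈)
open import Data.List.Relation.Binary.Sublist.Propositional.Properties as ⊆
  using (All-resp-⊆; Any-resp-⊆; length-mono-≤; filter⁺)
open import Data.List.Relation.Binary.Permutation.Propositional
  using (_↭_; ↭-sym; ↭-refl; ↭⇒↭ₛ; module PermutationReasoning)
import Data.List.Relation.Binary.Permutation.Propositional.Properties as ↭
open import Data.List.Relation.Binary.Permutation.Setoid.Properties using () renaming (Unique-resp-↭ to Unique-resp-↭ₛ)
open import Data.Product using (∃; ∃₂; _,_; proj₁; proj₂)
open import Data.Sum using (_⊎_; inj₁; inj₂)
import Data.Sum
open import Data.Empty using (⊥; ⊥-elim)
open import Function using (_∘_; id)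
open import Relation.Nullary using (¬_; Dec; yes; no)
open import Relation.Nullary.Decidable using (dec-true; dec-false; from-yes; ¬?)
open import Relation.Binary.PropositionalEquality
  using (_≡_; _≢_; refl; sym; trans; cong; cong₂; subst; subst₂; setoid; module ≡-Reasoning)
open import Relation.Binary.Definitions using (tri<; tri≈; tri>)

-- Ranks and standardisation

rank-∷-< : ∀ {x y} ys → y < x → rank x (y ∷ ys) ≡ suc (rank x ys)
rank-∷-< _ y<x = cong length (filter-accept (_<? _) y<x)

rank-∷-≮ : ∀ {x y} ys → y ≮ x → rank x (y ∷ ys) ≡ rank x ys
rank-∷-≮ _ y≮x = cong length (filter-reject (_<? _) y≮x)

rank-∷-self : ∀ x ys → rank x (x ∷ ys) ≡ rank x ys
rank-∷-self x ys = rank-∷-≮ ys (<-irrefl {x = x} refl)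

rank-++ : ∀ x xs ys → rank x (xs ++ ys) ≡ rank x xs + rank x ys
rank-++ x xs ys = trans (cong length (filter-++ (_<? x) xs ys)) (length-++ (filter (_<? x) xs))

rank-all< : ∀ {x ys} → All (_< x) ys → rank x ys ≡ length ys
rank-all< ys<x = cong length (filter-all (_<? _) ys<x)

rank-all≥ : ∀ {x ys} → All (x ≤_) ys → rank x ys ≡ 0
rank-all≥ x≤ys = cong length (filter-none (_<? _) (All.map ≤⇒≯ x≤ys))

rank-mono-≤ : ∀ {x y} zs → x ≤ y → rank x zs ≤ rank y zs
rank-mono-≤ zs x≤y = length-mono-≤ (filter⁺ (_<? _) (_<? _) (λ { refl z<x → <-≤-trans z<x x≤y }) (⊆-refl {x = zs}))

rank-<-mono : ∀ {x y} zs → x ∈ zs → x < y → rank x zs < rank y zs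
rank-<-mono {x} {y} zs x∈zs x<y with ∈-∃++ x∈zs
... | as , bs , refl = begin-strict
  rank x (as ++ x ∷ bs)          ≡⟨ rank-++ x as (x ∷ bs) ⟩
  rank x as + rank x (x ∷ bs)    ≡⟨ cong (rank x as +_) (rank-∷-self x bs) ⟩
  rank x as + rank x bs          ≤⟨ +-mono-≤ (rank-mono-≤ as (<⇒≤ x<y)) (rank-mono-≤ bs (<⇒≤ x<y)) ⟩
  rank y as + rank y bs          <⟨ +-monoʳ-< (rank y as) (n<1+n _) ⟩
  rank y as + suc (rank y bs)    ≡⟨ cong (rank y as +_) (rank-∷-< bs x<y) ⟨
  rank y as + rank y (x ∷ bs)    ≡⟨ rank-++ y as (x ∷ bs) ⟨
  rank y (as ++ x ∷ bs)          ∎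
  where open ≤-Reasoning

rank<length : ∀ {x} zs → x ∈ zs → rank x zs < length zs
rank<length {x} zs x∈zs with ∈-∃++ x∈zs
... | as , bs , refl = begin-strict
  rank x (as ++ x ∷ bs)          ≡⟨ rank-++ x as (x ∷ bs) ⟩
  rank x as + rank x (x ∷ bs)    ≡⟨ cong (rank x as +_) (rank-∷-self x bs) ⟩
  rank x as + rank x bs          ≤⟨ +-mono-≤ (length-filter (_<? x) as) (length-filter (_<? x) bs) ⟩
  length as + length bs          <⟨ +-monoʳ-< (length as) (n<1+n _) ⟩
  length as + length (x ∷ bs)    ≡⟨ length-++ as ⟨
  length (as ++ x ∷ bs)          ∎
  where open ≤-Reasoning

Bounded : List ℕ → Set
Bounded ρ = All (_< length ρ) ρ

std-length : ∀ ys → length (std ys) ≡ length ys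
std-length ys = length-map _ ys

std-bounded : ∀ ys → Bounded (std ys)
std-bounded ys rewrite std-length ys = All.map⁺ (All.tabulate (rank<length ys))

OrderIsoOn : (ℕ → ℕ) → List ℕ → Set
OrderIsoOn f xs = ∀ {a b} → a ∈ xs → b ∈ xs → (a < b → f a < f b) × (f a < f b → a < b)

StrictlyMonotone : (ℕ → ℕ) → Set
StrictlyMonotone f = ∀ {a b} → a < b → f a < f b

strictlyMonotone⇒orderIsoOn : ∀ {f} → StrictlyMonotone f → ∀ xs → OrderIsoOn f xs
strictlyMonotone⇒orderIsoOn {f} mono _ {a} {b} _ _ = mono , reflect
  where
  reflect : f a < f b → a < b
  reflect fa<fb with <-cmp a b
  ... | tri< a<b _ _ = a<b
  ... | tri≈ _ refl _ = ⊥-elim (<-irrefl refl fa<fb)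
  ... | tri> _ _ b<a = ⊥-elim (<-asym fa<fb (mono b<a))

rank-map : ∀ (f : ℕ → ℕ) x zs → (∀ {z} → z ∈ zs → (z < x → f z < f x) × (f z < f x → z < x)) →
  rank (f x) (map f zs) ≡ rank x zs
rank-map f x [] iso = refl
rank-map f x (z ∷ zs) iso with z <? x
... | yes z<x = trans (rank-∷-< (map f zs) (proj₁ (iso (here refl)) z<x))
                      (trans (cong suc (rank-map f x zs (iso ∘ there))) (sym (rank-∷-< zs z<x)))
... | no z≮x = trans (rank-∷-≮ (map f zs) (z≮x ∘ proj₂ (iso (here refl))))
                     (trans (rank-map f x zs (iso ∘ there)) (sym (rank-∷-≮ zs z≮x)))

std-map : ∀ (f : ℕ → ℕ) ys → OrderIsoOn f ys → std (map f ys) ≡ std ys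
std-map f ys iso =
  trans (sym (map-∘ ys)) (map-cong-local (All.tabulate λ y∈ys → rank-map f _ ys (λ z∈ys → iso z∈ys y∈ys)))

std-mono : ∀ {f} → StrictlyMonotone f → ∀ ys → std (map f ys) ≡ std ys
std-mono {f} mono ys = std-map f ys (strictlyMonotone⇒orderIsoOn mono ys)

_≪_ : List ℕ → List ℕ → Set
P ≪ Q = All (λ p → All (p <_) Q) P

std-++-⊕ : ∀ P Q → P ≪ Q → std (P ++ Q) ≡ std P ⊕ std Q
std-++-⊕ P Q P≪Q = trans (map-++ _ P Q) (cong₂ _++_ left right)
  where
  left : map (λ z → rank z (P ++ Q)) P ≡ std P
  left = map-cong-local (All.tabulate λ {z} z∈P → begin
    rank z (P ++ Q)        ≡⟨ rank-++ z P Q ⟩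
    rank z P + rank z Q    ≡⟨ cong (rank z P +_) (rank-all≥ (All.map <⇒≤ (All.lookup P≪Q z∈P))) ⟩
    rank z P + 0           ≡⟨ +-identityʳ _ ⟩
    rank z P               ∎)
    where open ≡-Reasoning
  right : map (λ z → rank z (P ++ Q)) Q ≡ map (length (std P) +_) (std Q)
  right = trans (map-cong-local (All.tabulate λ {z} z∈Q → begin
    rank z (P ++ Q)               ≡⟨ rank-++ z P Q ⟩
    rank z P + rank z Q           ≡⟨ cong (_+ rank z Q) (rank-all< (All.map (λ p≪Q → All.lookup p≪Q z∈Q) P≪Q)) ⟩
    length P + rank z Q           ≡⟨ cong (_+ rank z Q) (std-length P) ⟨
    length (std P) + rank z Q     ∎))
    (map-∘ Q)
    where open ≡-Reasoning

std-++-⊖ : ∀ P Q → Q ≪ P → std (P ++ Q) ≡ std P ⊖ std Q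
std-++-⊖ P Q Q≪P = trans (map-++ _ P Q) (cong₂ _++_ left right)
  where
  left : map (λ z → rank z (P ++ Q)) P ≡ map (_+ length (std Q)) (std P)
  left = trans (map-cong-local (All.tabulate λ {z} z∈P → begin
    rank z (P ++ Q)               ≡⟨ rank-++ z P Q ⟩
    rank z P + rank z Q           ≡⟨ cong (rank z P +_) (rank-all< (All.map (λ q≪P → All.lookup q≪P z∈P) Q≪P)) ⟩
    rank z P + length Q           ≡⟨ cong (rank z P +_) (std-length Q) ⟨
    rank z P + length (std Q)     ∎))
    (map-∘ P)
    where open ≡-Reasoning
  right : map (λ z → rank z (P ++ Q)) Q ≡ std Q
  right = map-cong-local (All.tabulate λ {z} z∈Q → begin
    rank z (P ++ Q)        ≡⟨ rank-++ z P Q ⟩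
    rank z P + rank z Q    ≡⟨ cong (_+ rank z Q) (rank-all≥ (All.map <⇒≤ (All.lookup Q≪P z∈Q))) ⟩
    rank z Q               ∎)
    where open ≡-Reasoning

std-singleton : ∀ v → std (v ∷ []) ≡ 0 ∷ []
std-singleton v = cong (_∷ []) (rank-∷-self v [])

-- Containment of patterns

Contains-⊆ : ∀ {ys xs ρ} → ys ⊆ xs → Contains ys ρ → Contains xs ρ
Contains-⊆ ys⊆xs (zs , zs⊆ys , eq) = zs , ⊆-trans zs⊆ys ys⊆xs , eq

Contains-std : ∀ xs → Contains xs (std xs)
Contains-std xs = xs , ⊆-refl , refl

map⁻-⊆ : ∀ (f : ℕ → ℕ) {zs} xs → zs ⊆ map f xs → ∃ λ ws → ws ⊆ xs × zs ≡ map f ws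
map⁻-⊆ f [] [] = [] , [] , refl
map⁻-⊆ f (x ∷ xs) (_ ∷ʳ zs⊆) with map⁻-⊆ f xs zs⊆
... | ws , ws⊆ , refl = ws , x ∷ʳ ws⊆ , refl
map⁻-⊆ f (x ∷ xs) (refl ∷ zs⊆) with map⁻-⊆ f xs zs⊆
... | ws , ws⊆ , refl = x ∷ ws , refl ∷ ws⊆ , refl

++⁻-⊆ : ∀ {zs} (xs ys : List ℕ) → zs ⊆ xs ++ ys → ∃₂ λ us vs → zs ≡ us ++ vs × us ⊆ xs × vs ⊆ ys
++⁻-⊆ [] ys zs⊆ = [] , _ , refl , [] , zs⊆
++⁻-⊆ (x ∷ xs) ys (_ ∷ʳ zs⊆) with ++⁻-⊆ xs ys zs⊆
... | us , vs , refl , us⊆ , vs⊆ = us , vs , refl , x ∷ʳ us⊆ , vs⊆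
++⁻-⊆ (x ∷ xs) ys (refl ∷ zs⊆) with ++⁻-⊆ xs ys zs⊆
... | us , vs , refl , us⊆ , vs⊆ = x ∷ us , vs , refl , refl ∷ us⊆ , vs⊆

Contains-trans : ∀ {π ρ σ} → Contains π ρ → Contains ρ σ → Contains π σ
Contains-trans (ys , ys⊆π , refl) (zs , zs⊆ρ , refl) with map⁻-⊆ (λ x → rank x ys) ys zs⊆ρ
... | ws , ws⊆ys , refl = ws , ⊆-trans ws⊆ys ys⊆π , sym (std-map (λ x → rank x ys) ws iso)
  where
  reflect : ∀ {a b} → b ∈ ys → rank a ys < rank b ys → a < b
  reflect {a} {b} b∈ys ra<rb with a <? b
  ... | yes a<b = a<b
  ... | no a≮b = ⊥-elim (<⇒≱ ra<rb (rank-mono-≤ ys (≮⇒≥ a≮b)))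
  iso : OrderIsoOn (λ x → rank x ys) ws
  iso a∈ b∈ = rank-<-mono ys (Any-resp-⊆ ws⊆ys a∈) , reflect (Any-resp-⊆ ws⊆ys b∈)

Contains-length : ∀ {xs ρ} → Contains xs ρ → length ρ ≤ length xs
Contains-length (ys , ys⊆xs , refl) = subst (_≤ _) (sym (std-length ys)) (length-mono-≤ ys⊆xs)

Contains-map : ∀ {f} → StrictlyMonotone f → ∀ {xs ρ} → Contains xs ρ → Contains (map f xs) ρ
Contains-map {f} mono (ys , ys⊆xs , eq) = map f ys , ⊆.map⁺ f ys⊆xs , trans (std-mono mono ys) eq

Contains-⊕ˡ : ∀ {α β ρ} → Contains α ρ → Contains (α ⊕ β) ρ
Contains-⊕ˡ {α} {β} = Contains-⊆ (⊆.++⁺ʳ (map (length α +_) β) ⊆-refl)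

Contains-⊕ʳ : ∀ {α β ρ} → Contains β ρ → Contains (α ⊕ β) ρ
Contains-⊕ʳ {α} = Contains-⊆ (⊆.++⁺ˡ α ⊆-refl) ∘ Contains-map (+-monoʳ-< (length α))

Contains-⊖ˡ : ∀ {α β ρ} → Contains α ρ → Contains (α ⊖ β) ρ
Contains-⊖ˡ {β = β} = Contains-⊆ (⊆.++⁺ʳ β ⊆-refl) ∘ Contains-map (+-monoˡ-< (length β))

Contains-⊖ʳ : ∀ {α β ρ} → Contains β ρ → Contains (α ⊖ β) ρ
Contains-⊖ʳ {α} {β} = Contains-⊆ (⊆.++⁺ˡ (map (_+ length β) α) ⊆-refl)

≪-+ˡ : ∀ {k ys} zs → All (_< k) ys → ys ≪ map (k +_) zs
≪-+ˡ {k} zs ys<k = All.map (λ y<k → All.map⁺ (All.universal (λ z → ≤-trans y<k (m≤m+n k z)) zs)) ys<k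

≪-+ʳ : ∀ {k ys} zs → All (_< k) ys → ys ≪ map (_+ k) zs
≪-+ʳ {k} zs ys<k = All.map (λ y<k → All.map⁺ (All.universal (λ z → ≤-trans y<k (m≤n+m k z)) zs)) ys<k

Contains-⊕ : ∀ {α β ρ ρ′} → Bounded α → Contains α ρ → Contains β ρ′ → Contains (α ⊕ β) (ρ ⊕ ρ′)
Contains-⊕ {α} α<n (ys , ys⊆α , refl) (zs , zs⊆β , refl) =
  ys ++ map (length α +_) zs , ⊆.++⁺ ys⊆α (⊆.map⁺ _ zs⊆β) ,
  trans (std-++-⊕ ys _ (≪-+ˡ zs (All-resp-⊆ ys⊆α α<n))) (cong (std ys ⊕_) (std-mono (+-monoʳ-< (length α)) zs))

Split : (List ℕ → List ℕ → List ℕ) → List ℕ → List ℕ → List ℕ → Set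
Split _∙_ α β ρ = ∃₂ λ ρ₁ ρ₂ → ρ ≡ ρ₁ ∙ ρ₂ × Contains α ρ₁ × Contains β ρ₂ × Bounded ρ₁ × Bounded ρ₂

split-⊕ : ∀ α β {ρ} → Bounded α → Contains (α ⊕ β) ρ → Split _⊕_ α β ρ
split-⊕ α β α<n (ys , ys⊆ , refl) with ++⁻-⊆ α (map (length α +_) β) ys⊆
... | us , vs , refl , us⊆α , vs⊆ with map⁻-⊆ (length α +_) β vs⊆
... | ws , ws⊆β , refl =
  std us , std ws ,
  trans (std-++-⊕ us _ (≪-+ˡ ws (All-resp-⊆ us⊆α α<n))) (cong (std us ⊕_) (std-mono (+-monoʳ-< (length α)) ws)) ,
  Contains-⊆ us⊆α (Contains-std us) , Contains-⊆ ws⊆β (Contains-std ws) , std-bounded us , std-bounded ws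

split-⊖ : ∀ α β {ρ} → Bounded β → Contains (α ⊖ β) ρ → Split _⊖_ α β ρ
split-⊖ α β β<n (ys , ys⊆ , refl) with ++⁻-⊆ (map (_+ length β) α) β ys⊆
... | us , vs , refl , us⊆ , vs⊆β with map⁻-⊆ (_+ length β) α us⊆
... | ws , ws⊆α , refl =
  std ws , std vs ,
  trans (std-++-⊖ _ vs (≪-+ʳ ws (All-resp-⊆ vs⊆β β<n))) (cong (_⊖ std vs) (std-mono (+-monoˡ-< (length β)) ws)) ,
  Contains-⊆ ws⊆α (Contains-std ws) , Contains-⊆ vs⊆β (Contains-std vs) , std-bounded ws , std-bounded vs

-- Permutations

Unique-⊆ : ∀ {xs ys : List ℕ} → xs ⊆ ys → Unique ys → Unique xs
Unique-⊆ [] [] = []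
Unique-⊆ (y ∷ʳ xs⊆ys) (_ ∷ u) = Unique-⊆ xs⊆ys u
Unique-⊆ (refl ∷ xs⊆ys) (y∉ys ∷ u) = All-resp-⊆ xs⊆ys y∉ys ∷ Unique-⊆ xs⊆ys u

Unique-resp-↭ : ∀ {xs ys : List ℕ} → xs ↭ ys → Unique xs → Unique ys
Unique-resp-↭ xs↭ys = Unique-resp-↭ₛ (setoid ℕ) (↭⇒↭ₛ xs↭ys)

Unique-map⁺-local : ∀ (f : ℕ → ℕ) {xs} → (∀ {a b} → a ∈ xs → b ∈ xs → f a ≡ f b → a ≡ b) →
  Unique xs → Unique (map f xs)
Unique-map⁺-local f {[]} inj [] = []
Unique-map⁺-local f {x ∷ xs} inj (x∉xs ∷ u) =
  All.map⁺ (All.tabulate λ y∈xs fx≡fy → All.lookup x∉xs y∈xs (inj (here refl) (there y∈xs) fx≡fy))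
  ∷ Unique-map⁺-local f (λ a∈ b∈ → inj (there a∈) (there b∈)) u

Unique-extract : ∀ as {n : ℕ} bs → Unique (as ++ n ∷ bs) → All (n ≢_) (as ++ bs) × Unique (as ++ bs)
Unique-extract as {n} bs u with Unique-resp-↭ (↭.shift n as bs) u
... | n∉ ∷ u′ = n∉ , u′

below-≢ : ∀ {n xs} → All (_≤ n) xs → All (n ≢_) xs → All (_< n) xs
below-≢ ≤n n≢ = All.zipWith (λ (x≤n , n≢x) → ≤∧≢⇒< x≤n (n≢x ∘ sym)) (≤n , n≢)

below-or-extract : ∀ n xs → Unique xs → All (_< suc n) xs →
  All (_< n) xs ⊎ ∃₂ λ as bs → xs ≡ as ++ n ∷ bs × Unique (as ++ bs) × All (_< n) (as ++ bs)
below-or-extract n xs u xs<1+n with n ∈? xs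
... | no n∉xs = inj₁ (below-≢ (All.map ≤-pred xs<1+n) (All.¬Any⇒All¬ xs n∉xs))
... | yes n∈xs with ∈-∃++ n∈xs
... | as , bs , refl with Unique-extract as bs u
... | n≢ , u′ = inj₂ (as , bs , refl , u′ ,
  below-≢ (All.map ≤-pred (All-resp-⊆ (⊆.++⁺ (⊆-refl {x = as}) (n ∷ʳ ⊆-refl)) xs<1+n)) n≢)

Unique⇒length≤ : ∀ n {xs} → Unique xs → All (_< n) xs → length xs ≤ n
Unique⇒length≤ zero {[]} _ _ = z≤n
Unique⇒length≤ zero {x ∷ xs} _ (() ∷ _)
Unique⇒length≤ (suc n) {xs} u xs< with below-or-extract n xs u xs<
... | inj₁ xs<n = m≤n⇒m≤1+n (Unique⇒length≤ n u xs<n)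
... | inj₂ (as , bs , refl , u′ , <n) =
  subst (_≤ suc n) (sym (length-++-sucʳ as n bs)) (s≤s (Unique⇒length≤ n u′ <n))

Unique⇒↭upTo : ∀ n {xs} → Unique xs → All (_< n) xs → length xs ≡ n → xs ↭ upTo n
Unique⇒↭upTo zero {[]} _ _ _ = ↭-refl
Unique⇒↭upTo (suc n) {xs} u xs< len with below-or-extract n xs u xs<
... | inj₁ xs<n = ⊥-elim (1+n≰n (subst (_≤ n) len (Unique⇒length≤ n u xs<n)))
... | inj₂ (as , bs , refl , u′ , <n) = begin
  as ++ n ∷ bs           ↭⟨ ↭.shift n as bs ⟩
  n ∷ as ++ bs           ↭⟨ ↭.++-comm (n ∷ []) (as ++ bs) ⟩
  (as ++ bs) ++ n ∷ []   ↭⟨ ↭.++⁺ʳ (n ∷ []) (Unique⇒↭upTo n u′ <n length≡) ⟩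
  upTo n ++ n ∷ []       ≡⟨ upTo-∷ʳ n ⟩
  upTo (suc n)           ∎
  where
  open PermutationReasoning
  length≡ : length (as ++ bs) ≡ n
  length≡ = suc-injective (trans (sym (length-++-sucʳ as n bs)) len)

applyUpTo-+ : ∀ (f : ℕ → ℕ) m n → applyUpTo f (m + n) ≡ applyUpTo f m ++ applyUpTo (λ x → f (m + x)) n
applyUpTo-+ f zero n = refl
applyUpTo-+ f (suc m) n = cong (f 0 ∷_) (applyUpTo-+ (f ∘ suc) m n)

upTo-+ : ∀ m n → upTo (m + n) ≡ upTo m ++ map (m +_) (upTo n)
upTo-+ m n = trans (applyUpTo-+ id m n) (cong (upTo m ++_) (sym (map-upTo (m +_) n)))

rank-upTo : ∀ {x n} → x ≤ n → rank x (upTo n) ≡ x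
rank-upTo {x} {n} x≤n = begin
  rank x (upTo n)                                         ≡⟨ cong (rank x ∘ upTo) (m+[n∸m]≡n x≤n) ⟨
  rank x (upTo (x + (n ∸ x)))                             ≡⟨ cong (rank x) (upTo-+ x (n ∸ x)) ⟩
  rank x (upTo x ++ map (x +_) (upTo (n ∸ x)))            ≡⟨ rank-++ x (upTo x) _ ⟩
  rank x (upTo x) + rank x (map (x +_) (upTo (n ∸ x)))    ≡⟨ cong₂ _+_ below above ⟩
  length (upTo x) + 0                                     ≡⟨ trans (+-identityʳ _) (length-upTo x) ⟩
  x                                                       ∎
  where
  open ≡-Reasoning
  below : rank x (upTo x) ≡ length (upTo x)
  below = rank-all< {x} {upTo x} (All.tabulate ∈-upTo⁻)
  above : rank x (map (x +_) (upTo (n ∸ x))) ≡ 0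
  above = rank-all≥ {x} {map (x +_) (upTo (n ∸ x))} (All.map⁺ (All.universal (m≤m+n x) (upTo (n ∸ x))))

IsPerm⇒bounded : ∀ {α} → IsPerm α → Bounded α
IsPerm⇒bounded α↭ = ↭.All-resp-↭ (↭-sym α↭) (All.tabulate ∈-upTo⁻)

IsPerm⇒Unique : ∀ {α} → IsPerm α → Unique α
IsPerm⇒Unique α↭ = Unique-resp-↭ (↭-sym α↭) (upTo⁺ _)

std-IsPerm : ∀ {π} → IsPerm π → std π ≡ π
std-IsPerm {π} π↭ = trans (map-cong-local (All.map rank≡ (IsPerm⇒bounded π↭))) (map-id π)
  where
  rank≡ : ∀ {x} → x < length π → rank x π ≡ x
  rank≡ {x} x<n = trans (↭.↭-length (↭.filter-↭ (_<? x) π↭)) (rank-upTo (<⇒≤ x<n))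

std-Unique : ∀ xs → Unique xs → Unique (std xs)
std-Unique xs = Unique-map⁺-local (λ x → rank x xs) injective
  where
  injective : ∀ {a b} → a ∈ xs → b ∈ xs → rank a xs ≡ rank b xs → a ≡ b
  injective {a} {b} a∈ b∈ ra≡rb with <-cmp a b
  ... | tri< a<b _ _ = ⊥-elim (<-irrefl ra≡rb (rank-<-mono xs a∈ a<b))
  ... | tri≈ _ a≡b _ = a≡b
  ... | tri> _ _ b<a = ⊥-elim (<-irrefl (sym ra≡rb) (rank-<-mono xs b∈ b<a))

IsPerm-std-⊆ : ∀ {ys π} → ys ⊆ π → IsPerm π → IsPerm (std ys)
IsPerm-std-⊆ {ys} ys⊆π π↭ =
  Unique⇒↭upTo _ (std-Unique ys (Unique-⊆ ys⊆π (IsPerm⇒Unique π↭))) (std-bounded ys) refl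

length-⊕ : ∀ α β → length (α ⊕ β) ≡ length α + length β
length-⊕ α β = trans (length-++ α) (cong (length α +_) (length-map _ β))

length-⊖ : ∀ α β → length (α ⊖ β) ≡ length α + length β
length-⊖ α β = trans (length-++ (map _ α)) (cong (_+ length β) (length-map _ α))

IsPerm-⊕ : ∀ {α β} → IsPerm α → IsPerm β → IsPerm (α ⊕ β)
IsPerm-⊕ {α} {β} α↭ β↭ = begin
  α ⊕ β                                          ↭⟨ ↭.++⁺ α↭ (↭.map⁺ (length α +_) β↭) ⟩
  upTo (length α) ++ map (length α +_) (upTo (length β)) ≡⟨ upTo-+ (length α) (length β) ⟨
  upTo (length α + length β)                     ≡⟨ cong upTo (length-⊕ α β) ⟨
  upTo (length (α ⊕ β))                          ∎
  where open PermutationReasoning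

IsPerm-⊖ : ∀ {α β} → IsPerm α → IsPerm β → IsPerm (α ⊖ β)
IsPerm-⊖ {α} {β} α↭ β↭ = begin
  map (_+ m) α ++ β                    ↭⟨ ↭.++-comm (map (_+ m) α) β ⟩
  β ++ map (_+ m) α                    ↭⟨ ↭.++⁺ β↭ (↭.map⁺ (_+ m) α↭) ⟩
  upTo m ++ map (_+ m) (upTo n)        ≡⟨ cong (upTo m ++_) (map-cong (λ x → +-comm x m) (upTo n)) ⟩
  upTo m ++ map (m +_) (upTo n)        ≡⟨ upTo-+ m n ⟨
  upTo (m + n)                         ≡⟨ cong upTo (trans (+-comm m n) (sym (length-⊖ α β))) ⟩
  upTo (length (α ⊖ β))                ∎
  where
  open PermutationReasoning
  n = length α
  m = length β

-- Inflations

<ᵇ-true : ∀ {m n} → m < n → (m <ᵇ n) ≡ true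
<ᵇ-true {m} {n} = dec-true (m <? n)

<ᵇ-false : ∀ {m n} → m ≮ n → (m <ᵇ n) ≡ false
<ᵇ-false {m} {n} = dec-false (m <? n)

+-<ᵇ-+ : ∀ n a s → (n + a <ᵇ n + s) ≡ (a <ᵇ s)
+-<ᵇ-+ zero a s = refl
+-<ᵇ-+ (suc n) a s = +-<ᵇ-+ n a s

-- inflate σ τs unfolds to blocks σ τs (offset σ τs).
offset : List ℕ → List (List ℕ) → ℕ → ℕ
offset σ τs s = sum (zipWith (λ s′ τ′ → if s′ <ᵇ s then length τ′ else 0) σ τs)

blocks : List ℕ → List (List ℕ) → (ℕ → ℕ) → List ℕ
blocks σ τs g = concat (zipWith (λ s τ → map (g s +_) τ) σ τs)

offset-++ : ∀ σ₁ τs₁ σ₂ τs₂ s → length σ₁ ≡ length τs₁ →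
  offset (σ₁ ++ σ₂) (τs₁ ++ τs₂) s ≡ offset σ₁ τs₁ s + offset σ₂ τs₂ s
offset-++ [] [] σ₂ τs₂ s _ = refl
offset-++ (x ∷ σ₁) (τ ∷ τs₁) σ₂ τs₂ s len =
  trans (cong ((if x <ᵇ s then length τ else 0) +_) (offset-++ σ₁ τs₁ σ₂ τs₂ s (suc-injective len)))
        (sym (+-assoc (if x <ᵇ s then length τ else 0) _ _))

offset-all≥ : ∀ {s} σ τs → All (s ≤_) σ → offset σ τs s ≡ 0
offset-all≥ [] τs _ = refl
offset-all≥ (x ∷ σ) [] _ = refl
offset-all≥ (x ∷ σ) (τ ∷ τs) (s≤x ∷ s≤σ) rewrite <ᵇ-false (≤⇒≯ s≤x) = offset-all≥ σ τs s≤σ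

offset-all< : ∀ {s} σ τs → All (_< s) σ → length σ ≡ length τs → offset σ τs s ≡ sum (map length τs)
offset-all< [] [] _ _ = refl
offset-all< (x ∷ σ) (τ ∷ τs) (x<s ∷ σ<s) len rewrite <ᵇ-true x<s =
  cong (length τ +_) (offset-all< σ τs σ<s (suc-injective len))

offset-map-+ˡ : ∀ n σ τs s → offset (map (n +_) σ) τs (n + s) ≡ offset σ τs s
offset-map-+ˡ n [] τs s = refl
offset-map-+ˡ n (x ∷ σ) [] s = refl
offset-map-+ˡ n (x ∷ σ) (τ ∷ τs) s rewrite +-<ᵇ-+ n x s =
  cong ((if x <ᵇ s then length τ else 0) +_) (offset-map-+ˡ n σ τs s)

offset-map-+ʳ : ∀ n σ τs s → offset (map (_+ n) σ) τs (s + n) ≡ offset σ τs s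
offset-map-+ʳ n σ τs s =
  trans (cong₂ (λ σ′ s′ → offset σ′ τs s′) (map-cong (λ x → +-comm x n) σ) (+-comm s n)) (offset-map-+ˡ n σ τs s)

blocks-++ : ∀ σ₁ τs₁ σ₂ τs₂ g → length σ₁ ≡ length τs₁ →
  blocks (σ₁ ++ σ₂) (τs₁ ++ τs₂) g ≡ blocks σ₁ τs₁ g ++ blocks σ₂ τs₂ g
blocks-++ [] [] σ₂ τs₂ g _ = refl
blocks-++ (x ∷ σ₁) (τ ∷ τs₁) σ₂ τs₂ g len =
  trans (cong (map (g x +_) τ ++_) (blocks-++ σ₁ τs₁ σ₂ τs₂ g (suc-injective len))) (sym (++-assoc (map (g x +_) τ) _ _))

blocks-cong : ∀ σ τs {g h : ℕ → ℕ} → All (λ s → g s ≡ h s) σ → blocks σ τs g ≡ blocks σ τs h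
blocks-cong [] τs _ = refl
blocks-cong (x ∷ σ) [] _ = refl
blocks-cong (x ∷ σ) (τ ∷ τs) (gx≡hx ∷ g≡h) = cong₂ _++_ (cong (λ k → map (k +_) τ) gx≡hx) (blocks-cong σ τs g≡h)

blocks-map : ∀ (f : ℕ → ℕ) σ τs g → blocks (map f σ) τs g ≡ blocks σ τs (g ∘ f)
blocks-map f [] τs g = refl
blocks-map f (x ∷ σ) [] g = refl
blocks-map f (x ∷ σ) (τ ∷ τs) g = cong (map (g (f x) +_) τ ++_) (blocks-map f σ τs g)

map-+-blocks : ∀ c σ τs g → map (c +_) (blocks σ τs g) ≡ blocks σ τs (λ s → c + g s)
map-+-blocks c [] τs g = refl
map-+-blocks c (x ∷ σ) [] g = refl
map-+-blocks c (x ∷ σ) (τ ∷ τs) g = trans (map-++ (c +_) (map (g x +_) τ) _)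
  (cong₂ _++_ (trans (sym (map-∘ τ)) (map-cong (λ y → sym (+-assoc c (g x) y)) τ)) (map-+-blocks c σ τs g))

map-blocks-+ : ∀ c σ τs g → map (_+ c) (blocks σ τs g) ≡ blocks σ τs (λ s → g s + c)
map-blocks-+ c σ τs g = begin
  map (_+ c) (blocks σ τs g)           ≡⟨ map-cong (λ y → +-comm y c) _ ⟩
  map (c +_) (blocks σ τs g)           ≡⟨ map-+-blocks c σ τs g ⟩
  blocks σ τs (λ s → c + g s)          ≡⟨ blocks-cong σ τs (All.universal (λ s → +-comm c (g s)) σ) ⟩
  blocks σ τs (λ s → g s + c)          ∎
  where open ≡-Reasoning

length-blocks : ∀ σ τs g → length σ ≡ length τs → length (blocks σ τs g) ≡ sum (map length τs)
length-blocks [] [] g _ = refl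
length-blocks (x ∷ σ) (τ ∷ τs) g len =
  trans (length-++ (map (g x +_) τ)) (cong₂ _+_ (length-map _ τ) (length-blocks σ τs g (suc-injective len)))

inflate-⊕ : ∀ α β τs₁ τs₂ → length α ≡ length τs₁ → Bounded α →
  inflate (α ⊕ β) (τs₁ ++ τs₂) ≡ inflate α τs₁ ⊕ inflate β τs₂
inflate-⊕ α β τs₁ τs₂ len α<n = trans (blocks-++ α τs₁ (map (n +_) β) τs₂ g len) (cong₂ _++_ left right)
  where
  n = length α
  g = offset (α ⊕ β) (τs₁ ++ τs₂)
  left : blocks α τs₁ g ≡ inflate α τs₁
  left = blocks-cong α τs₁ (All.map (λ {s} s<n → begin
    g s                                               ≡⟨ offset-++ α τs₁ (map (n +_) β) τs₂ s len ⟩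
    offset α τs₁ s + offset (map (n +_) β) τs₂ s      ≡⟨ cong (offset α τs₁ s +_) (offset-all≥ (map (n +_) β) τs₂
                                                           (All.map⁺ (All.universal (λ _ → ≤-trans (<⇒≤ s<n) (m≤m+n n _)) β))) ⟩
    offset α τs₁ s + 0                                ≡⟨ +-identityʳ _ ⟩
    offset α τs₁ s                                    ∎) α<n)
    where open ≡-Reasoning
  right : blocks (map (n +_) β) τs₂ g ≡ map (length (inflate α τs₁) +_) (inflate β τs₂)
  right = begin
    blocks (map (n +_) β) τs₂ g                                      ≡⟨ blocks-map (n +_) β τs₂ g ⟩
    blocks β τs₂ (g ∘ (n +_))                                         ≡⟨ blocks-cong β τs₂ (All.universal shifted β) ⟩
    blocks β τs₂ (λ s → length (inflate α τs₁) + offset β τs₂ s)     ≡⟨ map-+-blocks _ β τs₂ (offset β τs₂) ⟨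
    map (length (inflate α τs₁) +_) (inflate β τs₂)                  ∎
    where
    open ≡-Reasoning
    shifted : ∀ s → g (n + s) ≡ length (inflate α τs₁) + offset β τs₂ s
    shifted s = trans (offset-++ α τs₁ (map (n +_) β) τs₂ (n + s) len)
      (cong₂ _+_ (trans (offset-all< α τs₁ (All.map (λ x<n → ≤-trans x<n (m≤m+n n s)) α<n) len)
                        (sym (length-blocks α τs₁ (offset α τs₁) len)))
                 (offset-map-+ˡ n β τs₂ s))

inflate-⊖ : ∀ α β τs₁ τs₂ → length α ≡ length τs₁ → length β ≡ length τs₂ → Bounded β →
  inflate (α ⊖ β) (τs₁ ++ τs₂) ≡ inflate α τs₁ ⊖ inflate β τs₂
inflate-⊖ α β τs₁ τs₂ len₁ len₂ β<m = trans (blocks-++ (map (_+ m) α) τs₁ β τs₂ g len₁′) (cong₂ _++_ left right)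
  where
  m = length β
  g = offset (α ⊖ β) (τs₁ ++ τs₂)
  len₁′ = trans (length-map (_+ m) α) len₁
  left : blocks (map (_+ m) α) τs₁ g ≡ map (_+ length (inflate β τs₂)) (inflate α τs₁)
  left = begin
    blocks (map (_+ m) α) τs₁ g                                      ≡⟨ blocks-map (_+ m) α τs₁ g ⟩
    blocks α τs₁ (g ∘ (_+ m))                                         ≡⟨ blocks-cong α τs₁ (All.universal shifted α) ⟩
    blocks α τs₁ (λ s → offset α τs₁ s + length (inflate β τs₂))     ≡⟨ map-blocks-+ _ α τs₁ (offset α τs₁) ⟨
    map (_+ length (inflate β τs₂)) (inflate α τs₁)                  ∎
    where
    open ≡-Reasoning
    shifted : ∀ s → g (s + m) ≡ offset α τs₁ s + length (inflate β τs₂)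
    shifted s = trans (offset-++ (map (_+ m) α) τs₁ β τs₂ (s + m) len₁′)
      (cong₂ _+_ (offset-map-+ʳ m α τs₁ s)
                 (trans (offset-all< β τs₂ (All.map (λ x<m → ≤-trans x<m (m≤n+m m s)) β<m) len₂)
                        (sym (length-blocks β τs₂ (offset β τs₂) len₂))))
  right : blocks β τs₂ g ≡ inflate β τs₂
  right = blocks-cong β τs₂ (All.map (λ {s} s<m → begin
    g s                                               ≡⟨ offset-++ (map (_+ m) α) τs₁ β τs₂ s len₁′ ⟩
    offset (map (_+ m) α) τs₁ s + offset β τs₂ s      ≡⟨ cong (_+ offset β τs₂ s) (offset-all≥ (map (_+ m) α) τs₁
                                                           (All.map⁺ (All.universal (λ _ → ≤-trans (<⇒≤ s<m) (m≤n+m m _)) α))) ⟩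
    offset β τs₂ s                                    ∎) β<m)
    where open ≡-Reasoning

inflate-singleton : ∀ τ → inflate (0 ∷ []) (τ ∷ []) ≡ τ
inflate-singleton τ = trans (++-identityʳ (map (0 +_) τ)) (map-id τ)

-- Sum- and skew-indecomposable patterns

SumIndecomposable : List ℕ → Set
SumIndecomposable P = ∀ {ρ₁ ρ₂} → P ≡ ρ₁ ⊕ ρ₂ → Bounded ρ₁ → ρ₁ ≡ [] ⊎ ρ₂ ≡ []

SkewIndecomposable : List ℕ → Set
SkewIndecomposable P = ∀ {ρ₁ ρ₂} → P ≡ ρ₁ ⊖ ρ₂ → Bounded ρ₂ → ρ₁ ≡ [] ⊎ ρ₂ ≡ []

⊕-identityˡ : ∀ ρ → [] ⊕ ρ ≡ ρ
⊕-identityˡ = map-id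

⊕-identityʳ : ∀ ρ → ρ ⊕ [] ≡ ρ
⊕-identityʳ = ++-identityʳ

⊖-identityʳ : ∀ ρ → ρ ⊖ [] ≡ ρ
⊖-identityʳ ρ = trans (++-identityʳ _) (trans (map-cong +-identityʳ ρ) (map-id ρ))

Avoids-⊕ : ∀ {P α β} → SumIndecomposable P → Bounded α → Avoids α P → Avoids β P → Avoids (α ⊕ β) P
Avoids-⊕ {P} {α} {β} indec α<n α⊬P β⊬P α⊕β⊢P with split-⊕ α β α<n α⊕β⊢P
... | ρ₁ , ρ₂ , P≡ , α⊢ρ₁ , β⊢ρ₂ , ρ₁<n , _ with indec {ρ₁} {ρ₂} P≡ ρ₁<n
... | inj₁ refl = β⊬P (subst (Contains β) (sym (trans P≡ (⊕-identityˡ ρ₂))) β⊢ρ₂)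
... | inj₂ refl = α⊬P (subst (Contains α) (sym (trans P≡ (⊕-identityʳ ρ₁))) α⊢ρ₁)

Avoids-⊖ : ∀ {P α β} → SkewIndecomposable P → Bounded β → Avoids α P → Avoids β P → Avoids (α ⊖ β) P
Avoids-⊖ {P} {α} {β} indec β<n α⊬P β⊬P α⊖β⊢P with split-⊖ α β β<n α⊖β⊢P
... | ρ₁ , ρ₂ , P≡ , α⊢ρ₁ , β⊢ρ₂ , _ , ρ₂<n with indec {ρ₁} {ρ₂} P≡ ρ₂<n
... | inj₁ refl = β⊬P (subst (Contains β) (sym P≡) β⊢ρ₂)
... | inj₂ refl = α⊬P (subst (Contains α) (sym (trans P≡ (⊖-identityʳ ρ₁))) α⊢ρ₁)

properCuts : List ℕ → List ℕ
properCuts P = drop 1 (upTo (length P))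

∈-properCuts : ∀ {ρ₁ ρ₂ : List ℕ} → NonEmpty ρ₁ → NonEmpty ρ₂ → length ρ₁ ∈ properCuts (ρ₁ ++ ρ₂)
∈-properCuts {_ ∷ ρ₁} (_ , _ , refl) (_ , ρ₂ , refl) =
  ∈-applyUpTo⁺ suc (subst (length ρ₁ <_) (sym (length-++ ρ₁)) (m<m+n (length ρ₁) z<s))

take-length-++ : ∀ (xs ys : List ℕ) → take (length xs) (xs ++ ys) ≡ xs
take-length-++ [] ys = refl
take-length-++ (x ∷ xs) ys = cong (x ∷_) (take-length-++ xs ys)

drop-length-++ : ∀ (xs ys : List ℕ) → drop (length xs) (xs ++ ys) ≡ ys
drop-length-++ [] ys = refl
drop-length-++ (x ∷ xs) ys = drop-length-++ xs ys

NoLowerBlock : List ℕ → Set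
NoLowerBlock P = All (λ k → ¬ All (_< k) (take k P)) (properCuts P)

NoUpperBlock : List ℕ → Set
NoUpperBlock P = All (λ k → ¬ All (_< length P ∸ k) (drop k P)) (properCuts P)

noLowerBlock? : ∀ P → Dec (NoLowerBlock P)
noLowerBlock? P = All.all? (λ k → ¬? (All.all? (_<? k) (take k P))) (properCuts P)

noUpperBlock? : ∀ P → Dec (NoUpperBlock P)
noUpperBlock? P = All.all? (λ k → ¬? (All.all? (_<? length P ∸ k) (drop k P))) (properCuts P)

NoLowerBlock⇒SumIndecomposable : ∀ {P} → NoLowerBlock P → SumIndecomposable P
NoLowerBlock⇒SumIndecomposable _ {[]} _ _ = inj₁ refl
NoLowerBlock⇒SumIndecomposable _ {_ ∷ _} {[]} _ _ = inj₂ refl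
NoLowerBlock⇒SumIndecomposable noBlock {x ∷ ρ₁} {y ∷ ρ₂} refl ρ₁<n =
  ⊥-elim (All.lookup noBlock (∈-properCuts (x , ρ₁ , refl) (_ , _ , refl))
    (subst (All (_< length (x ∷ ρ₁))) (sym (take-length-++ (x ∷ ρ₁) _)) ρ₁<n))

NoUpperBlock⇒SkewIndecomposable : ∀ {P} → NoUpperBlock P → SkewIndecomposable P
NoUpperBlock⇒SkewIndecomposable _ {[]} _ _ = inj₁ refl
NoUpperBlock⇒SkewIndecomposable _ {_ ∷ _} {[]} _ _ = inj₂ refl
NoUpperBlock⇒SkewIndecomposable noBlock {x ∷ ρ₁} {y ∷ ρ₂} refl ρ₂<n =
  ⊥-elim (All.lookup noBlock (∈-properCuts {upper} (_ , _ , refl) (y , ρ₂ , refl))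
    (subst₂ (λ zs m → All (_< m) zs) (sym (drop-length-++ upper (y ∷ ρ₂))) remaining ρ₂<n))
  where
  upper = map (_+ length (y ∷ ρ₂)) (x ∷ ρ₁)
  remaining : length (y ∷ ρ₂) ≡ length (upper ++ y ∷ ρ₂) ∸ length upper
  remaining = sym (trans (cong (_∸ length upper) (length-++ upper)) (m+n∸m≡n (length upper) _))

p2413 p3142 p213 : List ℕ
p2413 = 1 ∷ 3 ∷ 0 ∷ 2 ∷ []
p3142 = 2 ∷ 0 ∷ 3 ∷ 1 ∷ []
p213 = 1 ∷ 0 ∷ 2 ∷ []

2413-sumIndecomposable : SumIndecomposable p2413
2413-sumIndecomposable = NoLowerBlock⇒SumIndecomposable (from-yes (noLowerBlock? p2413))

2413-skewIndecomposable : SkewIndecomposable p2413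
2413-skewIndecomposable = NoUpperBlock⇒SkewIndecomposable (from-yes (noUpperBlock? p2413))

3142-sumIndecomposable : SumIndecomposable p3142
3142-sumIndecomposable = NoLowerBlock⇒SumIndecomposable (from-yes (noLowerBlock? p3142))

3142-skewIndecomposable : SkewIndecomposable p3142
3142-skewIndecomposable = NoUpperBlock⇒SkewIndecomposable (from-yes (noUpperBlock? p3142))

213-skewIndecomposable : SkewIndecomposable p213
213-skewIndecomposable = NoUpperBlock⇒SkewIndecomposable (from-yes (noUpperBlock? p213))

-- Patterns of the form g ⊕ 1

first-common : ∀ {xs ys us vs : List ℕ} → xs ++ ys ≡ us ++ vs → NonEmpty xs → NonEmpty us → ∃ λ z → z ∈ xs × z ∈ us
first-common eq (x , _ , refl) (u , _ , refl) with ∷-injective eq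
... | refl , _ = x , here refl , here refl

last-common : ∀ {xs ys us vs : List ℕ} → xs ++ ys ≡ us ++ vs → NonEmpty ys → NonEmpty vs → ∃ λ z → z ∈ ys × z ∈ vs
last-common {xs} {ys} {us} {vs} eq _ _ with initLast ys | initLast vs
last-common _ (_ , _ , ()) _ | [] | _
last-common _ _ (_ , _ , ()) | _ ∷ʳ′ _ | []
last-common {xs} {_} {us} eq _ _ | ys ∷ʳ′ y | vs ∷ʳ′ v
  with ∷ʳ-injective (xs ++ ys) (us ++ vs) (trans (++-assoc xs ys _) (trans eq (sym (++-assoc us vs _))))
... | _ , refl = y , ∈-++⁺ʳ ys (here refl) , ∈-++⁺ʳ vs (here refl)

sum-skew-clash : ∀ {k m A B C D} → A ++ B ≡ C ++ D → NonEmpty A → NonEmpty B → NonEmpty C → NonEmpty D →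
  All (_< k) A → All (k ≤_) B → All (m ≤_) C → All (_< m) D → ⊥
sum-skew-clash {k} {m} eq neA neB neC neD A<k k≤B m≤C D<m
  with first-common eq neA neC | last-common eq neB neD
... | a , a∈A , a∈C | b , b∈B , b∈D = <-irrefl refl (begin-strict
  m   ≤⟨ All.lookup m≤C a∈C ⟩
  a   <⟨ All.lookup A<k a∈A ⟩
  k   ≤⟨ All.lookup k≤B b∈B ⟩
  b   <⟨ All.lookup D<m b∈D ⟩
  m   ∎)
  where open ≤-Reasoning

SkewDecomposable⇒IsPerm : ∀ {g} → SkewDecomposable g → IsPerm g
SkewDecomposable⇒IsPerm (_ , _ , α↭ , β↭ , _ , _ , refl) = IsPerm-⊖ α↭ β↭

SkewDecomposable⇒1<length : ∀ {g} → SkewDecomposable g → 1 < length g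
SkewDecomposable⇒1<length (_ , _ , _ , _ , (a , α , refl) , (b , β , refl) , refl) =
  subst (1 <_) (sym (length-⊖ (a ∷ α) (b ∷ β))) (s≤s (≤-trans (s≤s z≤n) (m≤n+m (suc (length β)) (length α))))

SkewDecomposable⇒SumIndecomposable : ∀ {g} → SkewDecomposable g → SumIndecomposable g
SkewDecomposable⇒SumIndecomposable _ {[]} _ _ = inj₁ refl
SkewDecomposable⇒SumIndecomposable _ {_ ∷ _} {[]} _ _ = inj₂ refl
SkewDecomposable⇒SumIndecomposable (α , β , _ , β↭ , neα , neβ , g≡α⊖β) {x ∷ ρ₁} {y ∷ ρ₂} g≡ρ₁⊕ρ₂ ρ₁<k =
  ⊥-elim (sum-skew-clash (trans (sym g≡ρ₁⊕ρ₂) g≡α⊖β) (x , ρ₁ , refl) (_ , _ , refl) (neMap neα) neβ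
    ρ₁<k (All.map⁺ (All.universal (m≤m+n _) (y ∷ ρ₂))) (All.map⁺ (All.universal (m≤n+m _) α)) (IsPerm⇒bounded β↭))
  where
  neMap : ∀ {xs} → NonEmpty xs → NonEmpty (map (_+ length β) xs)
  neMap (z , zs , refl) = _ , _ , refl

⊕1-skewIndecomposable : ∀ g → SkewIndecomposable (g ⊕ (0 ∷ []))
⊕1-skewIndecomposable g {[]} _ _ = inj₁ refl
⊕1-skewIndecomposable g {_ ∷ _} {[]} _ _ = inj₂ refl
⊕1-skewIndecomposable g {x ∷ ρ₁} {y ∷ ρ₂} eq ρ₂<n
  with last-common {us = map (_+ length (y ∷ ρ₂)) (x ∷ ρ₁)} eq (_ , [] , refl) (y , ρ₂ , refl)
... | z , here refl , z∈ρ₂ = ⊥-elim (<-irrefl refl (begin-strict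
  length g + 0                 <⟨ All.lookup ρ₂<n z∈ρ₂ ⟩
  length (y ∷ ρ₂)              ≤⟨ m≤n+m _ (length ρ₁) ⟩
  length ρ₁ + length (y ∷ ρ₂)  ≡⟨ suc-injective lengths ⟩
  length g                     ≡⟨ +-identityʳ _ ⟨
  length g + 0                 ∎))
  where
  open ≤-Reasoning
  lengths : suc (length ρ₁ + length (y ∷ ρ₂)) ≡ suc (length g)
  lengths = begin-equality
    suc (length ρ₁ + length (y ∷ ρ₂))  ≡⟨ length-⊖ (x ∷ ρ₁) (y ∷ ρ₂) ⟨
    length ((x ∷ ρ₁) ⊖ (y ∷ ρ₂))      ≡⟨ cong length eq ⟨
    length (g ⊕ (0 ∷ []))              ≡⟨ length-⊕ g (0 ∷ []) ⟩
    length g + 1                       ≡⟨ +-comm (length g) 1 ⟩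
    suc (length g)                     ∎

Contains-self : ∀ {π} → IsPerm π → Contains π π
Contains-self {π} π↭ = subst (Contains π) (std-IsPerm π↭) (Contains-std π)

-- ρ₁ is one of [], g and g ⊕ 1.
⊕1-prefix : ∀ {g} → IsPerm g → SumIndecomposable g →
  ∀ {ρ₁ ρ₂} → g ⊕ (0 ∷ []) ≡ ρ₁ ⊕ ρ₂ → Bounded ρ₁ → ρ₁ ≡ [] ⊎ Contains ρ₁ g
⊕1-prefix {g} g↭ indec {ρ₁} {ρ₂} eq ρ₁<k with initLast ρ₂
... | [] = inj₂ (subst (λ ρ → Contains ρ g) (trans eq (⊕-identityʳ ρ₁)) (Contains-⊕ˡ {g} (Contains-self g↭)))
... | I ∷ʳ′ w with ∷ʳ-injectiveˡ g (ρ₁ ⊕ I)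
                     (trans eq (trans (cong (ρ₁ ++_) (map-++ _ I (w ∷ []))) (sym (++-assoc ρ₁ (map _ I) _))))
...   | g≡ρ₁⊕I with indec {ρ₁} {I} g≡ρ₁⊕I ρ₁<k
...     | inj₁ ρ₁≡[] = inj₁ ρ₁≡[]
...     | inj₂ refl = inj₂ (subst (λ ρ → Contains ρ g) (trans g≡ρ₁⊕I (⊕-identityʳ ρ₁)) (Contains-self g↭))

-- Separable permutations are sums or skew sums

Occ2413 : List ℕ → Set
Occ2413 xs = ∃ λ a → ∃ λ b → ∃ λ c → ∃ λ d → (a ∷ b ∷ c ∷ d ∷ []) ⊆ xs × c < a × a < d × d < b

Occ3142 : List ℕ → Set
Occ3142 xs = ∃ λ a → ∃ λ b → ∃ λ c → ∃ λ d → (a ∷ b ∷ c ∷ d ∷ []) ⊆ xs × b < d × d < a × a < c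

Occ2413⇒Contains : ∀ {xs} → Occ2413 xs → Contains xs p2413
Occ2413⇒Contains (a , b , c , d , sub , c<a , a<d , d<b) =
  _ , sub , cong₂ _∷_ ra (cong₂ _∷_ rb (cong₂ _∷_ rc (cong (_∷ []) rd)))
  where
  c<d = <-trans c<a a<d
  c<b = <-trans c<d d<b
  a<b = <-trans a<d d<b
  ra : rank a (a ∷ b ∷ c ∷ d ∷ []) ≡ 1
  ra = trans (rank-∷-self a _) (trans (rank-∷-≮ (c ∷ d ∷ []) (<⇒≯ a<b))
         (trans (rank-∷-< (d ∷ []) c<a) (cong suc (rank-∷-≮ [] (<⇒≯ a<d)))))
  rb : rank b (a ∷ b ∷ c ∷ d ∷ []) ≡ 3
  rb = trans (rank-∷-< (b ∷ c ∷ d ∷ []) a<b) (cong suc (trans (rank-∷-self b _)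
         (trans (rank-∷-< (d ∷ []) c<b) (cong suc (rank-∷-< [] d<b)))))
  rc : rank c (a ∷ b ∷ c ∷ d ∷ []) ≡ 0
  rc = trans (rank-∷-≮ (b ∷ c ∷ d ∷ []) (<⇒≯ c<a)) (trans (rank-∷-≮ (c ∷ d ∷ []) (<⇒≯ c<b))
         (trans (rank-∷-self c _) (rank-∷-≮ [] (<⇒≯ c<d))))
  rd : rank d (a ∷ b ∷ c ∷ d ∷ []) ≡ 2
  rd = trans (rank-∷-< (b ∷ c ∷ d ∷ []) a<d) (cong suc (trans (rank-∷-≮ (c ∷ d ∷ []) (<⇒≯ d<b))
         (trans (rank-∷-< (d ∷ []) c<d) (cong suc (rank-∷-self d [])))))

Occ3142⇒Contains : ∀ {xs} → Occ3142 xs → Contains xs p3142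
Occ3142⇒Contains (a , b , c , d , sub , b<d , d<a , a<c) =
  _ , sub , cong₂ _∷_ ra (cong₂ _∷_ rb (cong₂ _∷_ rc (cong (_∷ []) rd)))
  where
  b<a = <-trans b<d d<a
  b<c = <-trans b<a a<c
  d<c = <-trans d<a a<c
  ra : rank a (a ∷ b ∷ c ∷ d ∷ []) ≡ 2
  ra = trans (rank-∷-self a _) (trans (rank-∷-< (c ∷ d ∷ []) b<a)
         (cong suc (trans (rank-∷-≮ (d ∷ []) (<⇒≯ a<c)) (rank-∷-< [] d<a))))
  rb : rank b (a ∷ b ∷ c ∷ d ∷ []) ≡ 0
  rb = trans (rank-∷-≮ (b ∷ c ∷ d ∷ []) (<⇒≯ b<a)) (trans (rank-∷-self b _)
         (trans (rank-∷-≮ (d ∷ []) (<⇒≯ b<c)) (rank-∷-≮ [] (<⇒≯ b<d))))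
  rc : rank c (a ∷ b ∷ c ∷ d ∷ []) ≡ 3
  rc = trans (rank-∷-< (b ∷ c ∷ d ∷ []) a<c) (cong suc (trans (rank-∷-< (c ∷ d ∷ []) b<c)
         (cong suc (trans (rank-∷-self c _) (rank-∷-< [] d<c)))))
  rd : rank d (a ∷ b ∷ c ∷ d ∷ []) ≡ 1
  rd = trans (rank-∷-≮ (b ∷ c ∷ d ∷ []) (<⇒≯ d<a)) (trans (rank-∷-< (c ∷ d ∷ []) b<d)
         (cong suc (trans (rank-∷-≮ (d ∷ []) (<⇒≯ d<c)) (rank-∷-self d []))))

Cut : List ℕ → Set
Cut xs = ∃₂ λ P Q → xs ≡ P ++ Q × NonEmpty P × NonEmpty Q × (P ≪ Q ⊎ Q ≪ P)

++-overlap : ∀ (L R P Q : List ℕ) → L ++ R ≡ P ++ Q →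
  (∃ λ M → L ≡ P ++ M × Q ≡ M ++ R) ⊎ (∃ λ M → P ≡ L ++ M × R ≡ M ++ Q)
++-overlap [] R P Q eq = inj₂ (P , refl , eq)
++-overlap (l ∷ L) R [] Q eq = inj₁ (l ∷ L , refl , sym eq)
++-overlap (l ∷ L) R (p ∷ P) Q eq with ∷-injective eq
... | refl , eq′ with ++-overlap L R P Q eq′
... | inj₁ (M , refl , Q≡) = inj₁ (M , refl , Q≡)
... | inj₂ (M , refl , R≡) = inj₂ (M , refl , R≡)

≪-or-inversion : ∀ A B → A ≪ B ⊎ ∃₂ λ a b → a ∈ A × b ∈ B × a ≮ b
≪-or-inversion A B with All.all? (λ a → All.all? (a <?_) B) A
... | yes A≪B = inj₁ A≪B
... | no A≪̸B with find (¬All⇒Any¬ (λ a → All.all? (a <?_) B) A A≪̸B)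
... | a , a∈A , a≮B with find (¬All⇒Any¬ (a <?_) B a≮B)
... | b , b∈B , a≮b = inj₂ (a , b , a∈A , b∈B , a≮b)

Unique-++-disjoint : ∀ A {B : List ℕ} {a b} → Unique (A ++ B) → a ∈ A → b ∈ B → a ≢ b
Unique-++-disjoint (x ∷ A) (x∉ ∷ _) (here refl) b∈B = All.lookup x∉ (∈-++⁺ʳ A b∈B)
Unique-++-disjoint (x ∷ A) (_ ∷ u) (there a∈A) b∈B = Unique-++-disjoint A u a∈A b∈B

≮∧≢⇒> : ∀ {a b} → a ≮ b → a ≢ b → b < a
≮∧≢⇒> a≮b a≢b = ≤∧≢⇒< (≮⇒≥ a≮b) (a≢b ∘ sym)

NonEmpty-++ˡ : ∀ {A} (B : List ℕ) → NonEmpty A → NonEmpty (A ++ B)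
NonEmpty-++ˡ B (a , A , refl) = a , A ++ B , refl

NonEmpty-++ʳ : ∀ (A : List ℕ) {B} → NonEmpty B → NonEmpty (A ++ B)
NonEmpty-++ʳ [] neB = neB
NonEmpty-++ʳ (a ∷ A) _ = a , A ++ _ , refl

-- a new maximum m either extends a side of the cut or creates a 2413 (m plays the 4)
insertMax-sumCut : ∀ L m R {P Q} → Unique (L ++ m ∷ R) → All (_< m) (L ++ R) → ¬ Occ2413 (L ++ m ∷ R) →
  L ++ R ≡ P ++ Q → NonEmpty P → NonEmpty Q → P ≪ Q → Cut (L ++ m ∷ R)
insertMax-sumCut L m R {P} {Q} u <m no2413 eq neP neQ P≪Q with ++-overlap L R P Q eq
... | inj₁ (M , refl , refl) =
  P , M ++ m ∷ R , ++-assoc P M (m ∷ R) , neP , NonEmpty-++ʳ M (m , R , refl) ,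
  inj₁ (All.tabulate λ p∈P → All.++⁺ (All.++⁻ˡ M (All.lookup P≪Q p∈P))
    (All.lookup <m (∈-++⁺ˡ (∈-++⁺ˡ p∈P)) ∷ All.++⁻ʳ M (All.lookup P≪Q p∈P)))
... | inj₂ (M , refl , refl) with L
...   | [] = m ∷ [] , M ++ Q , refl , (m , [] , refl) , NonEmpty-++ʳ M neQ ,
             inj₂ (All.tabulate λ z∈ → All.lookup <m z∈ ∷ [])
...   | l ∷ L′ with ≪-or-inversion (l ∷ L′) M
...     | inj₁ L≪M =
          l ∷ L′ , m ∷ M ++ Q , refl , (l , L′ , refl) , (m , M ++ Q , refl) ,
          inj₁ (All.tabulate λ a∈L → All.lookup <m (∈-++⁺ˡ a∈L)
            ∷ All.++⁺ (All.lookup L≪M a∈L) (All.lookup P≪Q (∈-++⁺ˡ a∈L)))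
...     | inj₂ (a , b , a∈L , b∈M , a≮b) with neQ
...       | q , Q′ , refl = ⊥-elim (no2413 (a , m , b , q ,
            ⊆.++⁺ (from∈ a∈L) (refl ∷ ⊆.++⁺ (from∈ b∈M) (refl ∷ minimum Q′)) ,
            ≮∧≢⇒> a≮b (Unique-++-disjoint (l ∷ L′) u a∈L (there (∈-++⁺ˡ b∈M))) ,
            All.lookup (All.lookup P≪Q (∈-++⁺ˡ a∈L)) (here refl) ,
            All.lookup <m (∈-++⁺ʳ (l ∷ L′) (∈-++⁺ʳ M (here refl)))))

-- symmetrically, a 3142 (m plays the 4)
insertMax-skewCut : ∀ L m R {P Q} → Unique (L ++ m ∷ R) → All (_< m) (L ++ R) → ¬ Occ3142 (L ++ m ∷ R) →
  L ++ R ≡ P ++ Q → NonEmpty P → NonEmpty Q → Q ≪ P → Cut (L ++ m ∷ R)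
insertMax-skewCut L m R {P} {Q} u <m no3142 eq neP neQ Q≪P with ++-overlap L R P Q eq
... | inj₂ (M , refl , refl) =
  L ++ m ∷ M , Q , sym (++-assoc L (m ∷ M) Q) , NonEmpty-++ʳ L (m , M , refl) , neQ ,
  inj₂ (All.tabulate λ q∈Q → All.++⁺ (All.++⁻ˡ L (All.lookup Q≪P q∈Q))
    (All.lookup <m (∈-++⁺ʳ L (∈-++⁺ʳ M q∈Q)) ∷ All.++⁻ʳ L (All.lookup Q≪P q∈Q)))
... | inj₁ (M , refl , refl) with R
...   | [] = P ++ M , m ∷ [] , refl , NonEmpty-++ˡ M neP , (m , [] , refl) ,
             inj₁ (All.tabulate λ z∈ → All.lookup <m (∈-++⁺ˡ z∈) ∷ [])
...   | r ∷ R′ with ≪-or-inversion (r ∷ R′) M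
...     | inj₁ R≪M =
          (P ++ M) ++ m ∷ [] , r ∷ R′ , sym (++-assoc (P ++ M) (m ∷ []) (r ∷ R′)) ,
          NonEmpty-++ˡ (m ∷ []) (NonEmpty-++ˡ M neP) , (r , R′ , refl) ,
          inj₂ (All.tabulate λ c∈R → All.++⁺ (All.++⁺ (All.lookup Q≪P (∈-++⁺ʳ M c∈R)) (All.lookup R≪M c∈R))
            (All.lookup <m (∈-++⁺ʳ (P ++ M) c∈R) ∷ []))
...     | inj₂ (c , b , c∈R , b∈M , c≮b) with neP
...       | p , P′ , refl = ⊥-elim (no3142 (p , b , m , c ,
            ⊆.++⁺ (⊆.++⁺ (refl ∷ minimum P′) (from∈ b∈M)) (refl ∷ from∈ c∈R) ,
            ≮∧≢⇒> c≮b (λ c≡b → Unique-++-disjoint (p ∷ P′ ++ M) u (∈-++⁺ʳ (p ∷ P′) b∈M) (there c∈R) (sym c≡b)) ,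
            All.lookup (All.lookup Q≪P (∈-++⁺ʳ M c∈R)) (here refl) ,
            All.lookup <m (∈-++⁺ˡ {ys = r ∷ R′} (∈-++⁺ˡ {ys = M} (here refl)))))

insertMax : ∀ L m R → Unique (L ++ m ∷ R) → All (_< m) (L ++ R) →
  ¬ Occ2413 (L ++ m ∷ R) → ¬ Occ3142 (L ++ m ∷ R) → Cut (L ++ R) → Cut (L ++ m ∷ R)
insertMax L m R u <m no2413 _ (P , Q , eq , neP , neQ , inj₁ P≪Q) = insertMax-sumCut L m R u <m no2413 eq neP neQ P≪Q
insertMax L m R u <m _ no3142 (P , Q , eq , neP , neQ , inj₂ Q≪P) = insertMax-skewCut L m R u <m no3142 eq neP neQ Q≪P

Occ2413-⊆ : ∀ {ys xs} → ys ⊆ xs → Occ2413 ys → Occ2413 xs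
Occ2413-⊆ ys⊆xs (a , b , c , d , sub , order) = a , b , c , d , ⊆-trans sub ys⊆xs , order

Occ3142-⊆ : ∀ {ys xs} → ys ⊆ xs → Occ3142 ys → Occ3142 xs
Occ3142-⊆ ys⊆xs (a , b , c , d , sub , order) = a , b , c , d , ⊆-trans sub ys⊆xs , order

max-element : ∀ x xs → ∃ λ m → m ∈ x ∷ xs × All (_≤ m) (x ∷ xs)
max-element x [] = x , here refl , ≤-refl ∷ []
max-element x (y ∷ ys) with max-element y ys
... | m , m∈ , ≤m with x ≤? m
... | yes x≤m = m , there m∈ , x≤m ∷ ≤m
... | no x≰m = x , here refl , ≤-refl ∷ All.map (λ z≤m → ≤-trans z≤m (<⇒≤ (≰⇒> x≰m))) ≤m

cut : ∀ n xs → length xs ≡ suc (suc n) → Unique xs → ¬ Occ2413 xs → ¬ Occ3142 xs → Cut xs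
cut zero (a ∷ b ∷ []) _ ((a≢b ∷ []) ∷ _) _ _ with <-cmp a b
... | tri< a<b _ _ = a ∷ [] , b ∷ [] , refl , (a , [] , refl) , (b , [] , refl) , inj₁ ((a<b ∷ []) ∷ [])
... | tri≈ _ a≡b _ = ⊥-elim (a≢b a≡b)
... | tri> _ _ b<a = a ∷ [] , b ∷ [] , refl , (a , [] , refl) , (b , [] , refl) , inj₂ ((b<a ∷ []) ∷ [])
cut (suc n) (x ∷ xs) len u no2413 no3142 with max-element x xs
... | m , m∈ , ≤m with ∈-∃++ m∈
... | L , R , eq = subst Cut (sym eq) (insertMax L m R u′ <m no2413′ no3142′
        (cut n (L ++ R) lenLR (proj₂ (Unique-extract L R u′)) (no2413′ ∘ Occ2413-⊆ drop-m) (no3142′ ∘ Occ3142-⊆ drop-m)))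
  where
  drop-m : L ++ R ⊆ L ++ m ∷ R
  drop-m = ⊆.++⁺ (⊆-refl {x = L}) (m ∷ʳ ⊆-refl)
  u′ : Unique (L ++ m ∷ R)
  u′ = subst Unique eq u
  no2413′ : ¬ Occ2413 (L ++ m ∷ R)
  no2413′ = no2413 ∘ subst Occ2413 (sym eq)
  no3142′ : ¬ Occ3142 (L ++ m ∷ R)
  no3142′ = no3142 ∘ subst Occ3142 (sym eq)
  <m : All (_< m) (L ++ R)
  <m = below-≢ (All-resp-⊆ drop-m (subst (All (_≤ m)) eq ≤m)) (proj₁ (Unique-extract L R u′))
  lenLR : length (L ++ R) ≡ suc (suc n)
  lenLR = suc-injective (trans (sym (length-++-sucʳ L m R)) (trans (cong length (sym eq)) len))

NonEmpty-std : ∀ {xs} → NonEmpty xs → NonEmpty (std xs)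
NonEmpty-std (_ , _ , refl) = _ , _ , refl

Separable⇒decomposable : ∀ {π} → Separable π → 2 ≤ length π →
  ∃₂ λ α β → IsPerm α × IsPerm β × NonEmpty α × NonEmpty β × (π ≡ α ⊕ β ⊎ π ≡ α ⊖ β)
Separable⇒decomposable {π} (π↭ , π⊬2413 , π⊬3142) 2≤n
  with cut (length π ∸ 2) π (sym (m+[n∸m]≡n 2≤n)) (IsPerm⇒Unique π↭)
         (π⊬2413 ∘ Occ2413⇒Contains) (π⊬3142 ∘ Occ3142⇒Contains)
... | P , Q , refl , neP , neQ , side =
  std P , std Q , IsPerm-std-⊆ (⊆.++⁺ʳ Q ⊆-refl) π↭ , IsPerm-std-⊆ (⊆.++⁺ˡ P ⊆-refl) π↭ ,
  NonEmpty-std neP , NonEmpty-std neQ ,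
  Data.Sum.map (trans π≡std ∘ std-++-⊕ P Q) (trans π≡std ∘ std-++-⊖ P Q) side
  where
  π≡std : P ++ Q ≡ std (P ++ Q)
  π≡std = sym (std-IsPerm π↭)

-- Decomposition of 213-avoiders

Occ213⇒Contains : ∀ {xs a b c} → (a ∷ b ∷ c ∷ []) ⊆ xs → b < a → a < c → Contains xs p213
Occ213⇒Contains {a = a} {b} {c} sub b<a a<c = _ , sub , cong₂ _∷_ ra (cong₂ _∷_ rb (cong (_∷ []) rc))
  where
  b<c = <-trans b<a a<c
  ra : rank a (a ∷ b ∷ c ∷ []) ≡ 1
  ra = trans (rank-∷-self a _) (trans (rank-∷-< (c ∷ []) b<a) (cong suc (rank-∷-≮ [] (<⇒≯ a<c))))
  rb : rank b (a ∷ b ∷ c ∷ []) ≡ 0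
  rb = trans (rank-∷-≮ (b ∷ c ∷ []) (<⇒≯ b<a)) (trans (rank-∷-self b _) (rank-∷-≮ [] (<⇒≯ b<c)))
  rc : rank c (a ∷ b ∷ c ∷ []) ≡ 2
  rc = trans (rank-∷-< (b ∷ c ∷ []) a<c) (cong suc (trans (rank-∷-< (c ∷ []) b<c) (cong suc (rank-∷-self c []))))

Avoids-resp-Contains : ∀ {π ρ P} → Contains π ρ → Avoids π P → Avoids ρ P
Avoids-resp-Contains π⊢ρ π⊬P ρ⊢P = π⊬P (Contains-trans π⊢ρ ρ⊢P)

Av213-resp-Contains : ∀ {π ρ} → Contains π ρ → IsPerm ρ → Av213 π → Av213 ρ
Av213-resp-Contains π⊢ρ ρ↭ (_ , π⊬213) = ρ↭ , Avoids-resp-Contains π⊢ρ π⊬213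

Contains-std-⊆ : ∀ {ys xs} → ys ⊆ xs → Contains xs (std ys)
Contains-std-⊆ {ys} ys⊆xs = Contains-⊆ ys⊆xs (Contains-std ys)

span-above : ∀ v xs → ∃₂ λ G S → xs ≡ G ++ S × All (v <_) G × (S ≡ [] ⊎ ∃₂ λ s S′ → S ≡ s ∷ S′ × v ≮ s)
span-above v [] = [] , [] , refl , [] , inj₁ refl
span-above v (x ∷ xs) with v <? x
... | no v≮x = [] , x ∷ xs , refl , [] , inj₂ (x , xs , refl , v≮x)
... | yes v<x with span-above v xs
... | G , S , refl , v<G , head = x ∷ G , S , refl , v<x ∷ v<G , head

-- a value above v after a value below v would complete a 213
Av213-tail-below : ∀ {v} G S → Unique (v ∷ G ++ S) → Avoids (v ∷ G ++ S) p213 →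
  (S ≡ [] ⊎ ∃₂ λ s S′ → S ≡ s ∷ S′ × v ≮ s) → All (_< v) S
Av213-tail-below G _ _ _ (inj₁ refl) = []
Av213-tail-below {v} G _ (v∉ ∷ _) π⊬213 (inj₂ (s , S′ , refl , v≮s)) = s<v ∷ All.tabulate later<v
  where
  v≢ : ∀ {z} → z ∈ s ∷ S′ → v ≢ z
  v≢ z∈S = All.lookup v∉ (∈-++⁺ʳ G z∈S)
  s<v = ≮∧≢⇒> v≮s (v≢ (here refl))
  later<v : ∀ {z} → z ∈ S′ → z < v
  later<v {z} z∈S′ with v <? z
  ... | no v≮z = ≮∧≢⇒> v≮z (v≢ (there z∈S′))
  ... | yes v<z = ⊥-elim (π⊬213 (Occ213⇒Contains (refl ∷ ⊆.++⁺ˡ G (refl ∷ from∈ z∈S′)) s<v v<z))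

Av213-decompose : ∀ {v rest} → Av213 (v ∷ rest) →
  ∃₂ λ γ δ → v ∷ rest ≡ ((0 ∷ []) ⊕ γ) ⊖ δ × Av213 γ × Av213 δ
Av213-decompose {v} {rest} av@(π↭ , π⊬213) with span-above v rest
... | G , S , refl , v<G , head =
  std G , std S , decomposition ,
  Av213-resp-Contains (Contains-std-⊆ G⊆) (IsPerm-std-⊆ G⊆ π↭) av ,
  Av213-resp-Contains (Contains-std-⊆ S⊆) (IsPerm-std-⊆ S⊆ π↭) av
  where
  G⊆ : G ⊆ v ∷ G ++ S
  G⊆ = v ∷ʳ ⊆.++⁺ʳ S ⊆-refl
  S⊆ : S ⊆ v ∷ G ++ S
  S⊆ = v ∷ʳ ⊆.++⁺ˡ G ⊆-refl
  S<v : All (_< v) S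
  S<v = Av213-tail-below G S (IsPerm⇒Unique π↭) π⊬213 head
  decomposition : v ∷ G ++ S ≡ ((0 ∷ []) ⊕ std G) ⊖ std S
  decomposition = begin
    v ∷ G ++ S                        ≡⟨ std-IsPerm π↭ ⟨
    std ((v ∷ G) ++ S)                ≡⟨ std-++-⊖ (v ∷ G) S (All.map (λ s<v → s<v ∷ All.map (<-trans s<v) v<G) S<v) ⟩
    std (v ∷ G) ⊖ std S               ≡⟨ cong (_⊖ std S) (std-++-⊕ (v ∷ []) G (v<G ∷ [])) ⟩
    (std (v ∷ []) ⊕ std G) ⊖ std S    ≡⟨ cong (λ ρ → (ρ ⊕ std G) ⊖ std S) (std-singleton v) ⟩
    ((0 ∷ []) ⊕ std G) ⊖ std S        ∎
    where open ≡-Reasoning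

Avoids-1⊕-213 : ∀ {σ} → Avoids σ p213 → Avoids ((0 ∷ []) ⊕ σ) p213
Avoids-1⊕-213 {σ} σ⊬213 c with split-⊕ (0 ∷ []) σ (z<s ∷ []) c
... | [] , ρ₂ , eq , _ , σ⊢ρ₂ , _ = σ⊬213 (subst (Contains σ) (sym (trans eq (⊕-identityˡ ρ₂))) σ⊢ρ₂)
... | x ∷ [] , _ , eq , _ , _ , (x<1 ∷ []) , _ with ∷-injective eq
...   | refl , _ = <-irrefl refl x<1
Avoids-1⊕-213 _ _ | _ ∷ _ ∷ _ , _ , _ , [0]⊢ρ₁ , _ with Contains-length [0]⊢ρ₁
... | s≤s ()

-- Closure properties of the classes involved

AvoidsAll : (List ℕ → Set) → List ℕ → Set
AvoidsAll H π = ∀ σ → H σ → Avoids π σ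

Separable-⊕ : ∀ {α β} → Separable α → Separable β → Separable (α ⊕ β)
Separable-⊕ (α↭ , α⊬2413 , α⊬3142) (β↭ , β⊬2413 , β⊬3142) =
  IsPerm-⊕ α↭ β↭ ,
  Avoids-⊕ 2413-sumIndecomposable (IsPerm⇒bounded α↭) α⊬2413 β⊬2413 ,
  Avoids-⊕ 3142-sumIndecomposable (IsPerm⇒bounded α↭) α⊬3142 β⊬3142

Separable-⊖ : ∀ {α β} → Separable α → Separable β → Separable (α ⊖ β)
Separable-⊖ (α↭ , α⊬2413 , α⊬3142) (β↭ , β⊬2413 , β⊬3142) =
  IsPerm-⊖ α↭ β↭ ,
  Avoids-⊖ 2413-skewIndecomposable (IsPerm⇒bounded β↭) α⊬2413 β⊬2413 ,
  Avoids-⊖ 3142-skewIndecomposable (IsPerm⇒bounded β↭) α⊬3142 β⊬3142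

AvS-resp-Contains : ∀ {H π ρ} → Contains π ρ → IsPerm ρ → AvS H π → AvS H ρ
AvS-resp-Contains π⊢ρ ρ↭ ((_ , π⊬2413 , π⊬3142) , π⊬H) =
  (ρ↭ , Avoids-resp-Contains π⊢ρ π⊬2413 , Avoids-resp-Contains π⊢ρ π⊬3142) ,
  λ σ Hσ → Avoids-resp-Contains π⊢ρ (π⊬H σ Hσ)

AvS-⊖⁻ : ∀ {H α β} → IsPerm α → IsPerm β → AvS H (α ⊖ β) → AvS H α × AvS H β
AvS-⊖⁻ {β = β} α↭ β↭ α⊖β∈ =
  AvS-resp-Contains (Contains-⊖ˡ {β = β} (Contains-self α↭)) α↭ α⊖β∈ ,
  AvS-resp-Contains (Contains-⊖ʳ (Contains-self β↭)) β↭ α⊖β∈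

Avoids-[] : ∀ {ρ} → NonEmpty ρ → Avoids [] ρ
Avoids-[] (_ , _ , refl) []⊢ρ with Contains-length []⊢ρ
... | ()

AvS-[] : ∀ {H} → (∀ {σ} → H σ → NonEmpty σ) → AvS H []
AvS-[] nonEmpty = (↭-refl , Avoids-[] (_ , _ , refl) , Avoids-[] (_ , _ , refl)) , λ σ Hσ → Avoids-[] (nonEmpty Hσ)

AvoidsAll-⊕1-⊖ : ∀ {H α β} → IsPerm β → AvoidsAll (H ⊕1) α → AvoidsAll (H ⊕1) β → AvoidsAll (H ⊕1) (α ⊖ β)
AvoidsAll-⊕1-⊖ β↭ α⊬ β⊬ _ (g , Hg , refl) =
  Avoids-⊖ (⊕1-skewIndecomposable g) (IsPerm⇒bounded β↭) (α⊬ _ (g , Hg , refl)) (β⊬ _ (g , Hg , refl))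

Av213-[] : Av213 []
Av213-[] = ↭-refl , Avoids-[] (_ , _ , refl)

Av213-1⊕ : ∀ {σ} → Av213 σ → Av213 ((0 ∷ []) ⊕ σ)
Av213-1⊕ (σ↭ , σ⊬213) = IsPerm-⊕ ↭-refl σ↭ , Avoids-1⊕-213 σ⊬213

Av213-⊖ : ∀ {α β} → Av213 α → Av213 β → Av213 (α ⊖ β)
Av213-⊖ (α↭ , α⊬213) (β↭ , β⊬213) =
  IsPerm-⊖ α↭ β↭ , Avoids-⊖ 213-skewIndecomposable (IsPerm⇒bounded β↭) α⊬213 β⊬213

++-split : ∀ {A : Set} m n (xs : List A) → length xs ≡ m + n →
  ∃₂ λ ys zs → xs ≡ ys ++ zs × length ys ≡ m × length zs ≡ n
++-split zero n xs len = [] , xs , refl , refl , len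
++-split (suc m) n (x ∷ xs) len with ++-split m n xs (suc-injective len)
... | ys , zs , refl , refl , refl = x ∷ ys , zs , refl , refl , refl

length-1⊕⊖ : ∀ γ δ → length (((0 ∷ []) ⊕ γ) ⊖ δ) ≡ suc (length γ + length δ)
length-1⊕⊖ γ δ = trans (length-⊖ ((0 ∷ []) ⊕ γ) δ) (cong (_+ length δ) (length-⊕ (0 ∷ []) γ))

inflate-1⊕⊖ : ∀ τ γ δ τs₁ τs₂ → length γ ≡ length τs₁ → length δ ≡ length τs₂ → Bounded δ →
  inflate (((0 ∷ []) ⊕ γ) ⊖ δ) ((τ ∷ τs₁) ++ τs₂) ≡ (τ ⊕ inflate γ τs₁) ⊖ inflate δ τs₂
inflate-1⊕⊖ τ γ δ τs₁ τs₂ len₁ len₂ δ<n = begin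
  inflate (((0 ∷ []) ⊕ γ) ⊖ δ) ((τ ∷ τs₁) ++ τs₂)
    ≡⟨ inflate-⊖ ((0 ∷ []) ⊕ γ) δ (τ ∷ τs₁) τs₂ (trans (length-⊕ (0 ∷ []) γ) (cong suc len₁)) len₂ δ<n ⟩
  inflate ((0 ∷ []) ⊕ γ) ((τ ∷ []) ++ τs₁) ⊖ inflate δ τs₂
    ≡⟨ cong (_⊖ inflate δ τs₂) (inflate-⊕ (0 ∷ []) γ (τ ∷ []) τs₁ refl (z<s ∷ [])) ⟩
  (inflate (0 ∷ []) (τ ∷ []) ⊕ inflate γ τs₁) ⊖ inflate δ τs₂
    ≡⟨ cong (λ ρ → (ρ ⊕ inflate γ τs₁) ⊖ inflate δ τs₂) (inflate-singleton τ) ⟩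
  (τ ⊕ inflate γ τs₁) ⊖ inflate δ τs₂
    ∎
  where open ≡-Reasoning

Inflations-1⊕ : ∀ {E α β} → E α → Inflations Av213 E β → Inflations Av213 E (α ⊕ β)
Inflations-1⊕ {α = α} α∈ (σ , τs , σ∈ , len , τs∈ , refl) =
  (0 ∷ []) ⊕ σ , α ∷ τs , Av213-1⊕ σ∈ , trans (cong suc len) (sym (length-⊕ (0 ∷ []) σ)) , α∈ ∷ τs∈ ,
  sym (trans (inflate-⊕ (0 ∷ []) σ (α ∷ []) τs refl (z<s ∷ [])) (cong (_⊕ inflate σ τs) (inflate-singleton α)))

Inflations-⊖ : ∀ {E α β} → Inflations Av213 E α → Inflations Av213 E β → Inflations Av213 E (α ⊖ β)
Inflations-⊖ (σ₁ , τs₁ , σ₁∈ , len₁ , τs₁∈ , refl) (σ₂ , τs₂ , σ₂∈ , len₂ , τs₂∈ , refl) =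
  σ₁ ⊖ σ₂ , τs₁ ++ τs₂ , Av213-⊖ σ₁∈ σ₂∈ ,
  trans (length-++ τs₁) (trans (cong₂ _+_ len₁ len₂) (sym (length-⊖ σ₁ σ₂))) , All.++⁺ τs₁∈ τs₂∈ ,
  sym (inflate-⊖ σ₁ σ₂ τs₁ τs₂ (sym len₁) (sym len₂) (IsPerm⇒bounded (proj₁ σ₂∈)))

Contains-⊕1 : ∀ {α β g} → Bounded α → NonEmpty β → Contains α g → Contains (α ⊕ β) (g ⊕ (0 ∷ []))
Contains-⊕1 α<n (b , β , refl) α⊢g = Contains-⊕ α<n α⊢g (b ∷ [] , refl ∷ minimum β , std-singleton b)

summands-shorter : ∀ {n α β} → NonEmpty α → NonEmpty β → length α + length β ≤ suc n →
  length α ≤ n × length β ≤ n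
summands-shorter {α = α} {β} (_ , _ , refl) (_ , _ , refl) le =
  ≤-pred (≤-trans (m<m+n (length α) z<s) le) , ≤-pred (≤-trans (m<n+m (length β) z<s) le)

-- The two inclusions

module _ (F : List ℕ → Set) (F-skew : ∀ {g} → F g → SkewDecomposable g) where

  F⊕1-nonEmpty : ∀ {ρ} → (F ⊕1) ρ → NonEmpty ρ
  F⊕1-nonEmpty (g , _ , refl) = NonEmpty-++ʳ g (_ , [] , refl)

  AvoidsAll-F⊕1-⊕ : ∀ {τ A} → IsPerm τ → AvoidsAll F τ → AvoidsAll (F ⊕1) A → AvoidsAll (F ⊕1) (τ ⊕ A)
  AvoidsAll-F⊕1-⊕ {τ} {A} τ↭ τ⊬F A⊬ _ (g , Fg , refl) τ⊕A⊢ with split-⊕ τ A (IsPerm⇒bounded τ↭) τ⊕A⊢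
  ... | ρ₁ , ρ₂ , eq , τ⊢ρ₁ , A⊢ρ₂ , ρ₁<n , _
    with ⊕1-prefix (SkewDecomposable⇒IsPerm (F-skew Fg)) (SkewDecomposable⇒SumIndecomposable (F-skew Fg))
                   {ρ₁} {ρ₂} eq ρ₁<n
  ... | inj₁ refl = A⊬ _ (g , Fg , refl) (subst (Contains A) (sym (trans eq (⊕-identityˡ ρ₂))) A⊢ρ₂)
  ... | inj₂ ρ₁⊢g = τ⊬F g Fg (Contains-trans τ⊢ρ₁ ρ₁⊢g)

  sumSkew-closed : ∀ {τ A B} → AvS F τ → AvS (F ⊕1) A → AvS (F ⊕1) B → AvS (F ⊕1) ((τ ⊕ A) ⊖ B)
  sumSkew-closed (τ-sep , τ⊬) (A-sep , A⊬) (B-sep , B⊬) =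
    Separable-⊖ (Separable-⊕ τ-sep A-sep) B-sep ,
    AvoidsAll-⊕1-⊖ (proj₁ B-sep) (AvoidsAll-F⊕1-⊕ (proj₁ τ-sep) τ⊬ A⊬) B⊬

  inflate-AvS : ∀ n σ τs → length σ ≤ n → Av213 σ → length τs ≡ length σ → All (AvS F) τs →
    AvS (F ⊕1) (inflate σ τs)
  inflate-AvS _ [] [] _ _ _ _ = AvS-[] F⊕1-nonEmpty
  inflate-AvS (suc n) (v ∷ rest) (τ ∷ τs) |σ|≤ σ∈ len (τ∈ ∷ τs∈) with Av213-decompose σ∈
  ... | γ , δ , σ≡ , γ∈ , δ∈
    with ++-split (length γ) (length δ) τs (suc-injective (trans len (trans (cong length σ≡) (length-1⊕⊖ γ δ))))
  ... | τs₁ , τs₂ , refl , len₁ , len₂ with All.++⁻ τs₁ τs∈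
  ... | τs₁∈ , τs₂∈ =
    subst (AvS (F ⊕1)) (sym inflation≡)
      (sumSkew-closed τ∈ (inflate-AvS n γ τs₁ |γ|≤n γ∈ len₁ τs₁∈) (inflate-AvS n δ τs₂ |δ|≤n δ∈ len₂ τs₂∈))
    where
    inflation≡ : inflate (v ∷ rest) (τ ∷ τs₁ ++ τs₂) ≡ (τ ⊕ inflate γ τs₁) ⊖ inflate δ τs₂
    inflation≡ = trans (cong (λ σ → inflate σ (τ ∷ τs₁ ++ τs₂)) σ≡)
      (inflate-1⊕⊖ τ γ δ τs₁ τs₂ (sym len₁) (sym len₂) (IsPerm⇒bounded (proj₁ δ∈)))
    |γ|+|δ|≤n : length γ + length δ ≤ n
    |γ|+|δ|≤n = ≤-pred (subst (_≤ suc n) (trans (cong length σ≡) (length-1⊕⊖ γ δ)) |σ|≤)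
    |γ|≤n : length γ ≤ n
    |γ|≤n = ≤-trans (m≤m+n _ _) |γ|+|δ|≤n
    |δ|≤n : length δ ≤ n
    |δ|≤n = ≤-trans (m≤n+m _ _) |γ|+|δ|≤n

  AvS-⊕⁻ : ∀ {α β} → IsPerm α → IsPerm β → NonEmpty β → AvS (F ⊕1) (α ⊕ β) → AvS F α × AvS (F ⊕1) β
  AvS-⊕⁻ {α} α↭ β↭ neβ α⊕β∈@(_ , α⊕β⊬) =
    (proj₁ (AvS-resp-Contains (Contains-⊕ˡ (Contains-self α↭)) α↭ α⊕β∈) ,
     λ g Fg α⊢g → α⊕β⊬ _ (g , Fg , refl) (Contains-⊕1 (IsPerm⇒bounded α↭) neβ α⊢g)) ,
    AvS-resp-Contains (Contains-⊕ʳ {α} (Contains-self β↭)) β↭ α⊕β∈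

  AvS-singleton : ∀ {x} → AvS (F ⊕1) (x ∷ []) → AvS F (x ∷ [])
  AvS-singleton (x-sep , _) =
    x-sep , λ g Fg x⊢g → <⇒≱ (SkewDecomposable⇒1<length (F-skew Fg)) (Contains-length x⊢g)

  AvS⊆Inflations : ∀ n π → length π ≤ n → AvS (F ⊕1) π → Inflations Av213 (AvS F) π
  decomposable⇒Inflations : ∀ n {π} → 2 ≤ length π → length π ≤ suc n → AvS (F ⊕1) π →
    Inflations Av213 (AvS F) π

  AvS⊆Inflations _ [] _ _ = [] , [] , Av213-[] , refl , [] , refl
  AvS⊆Inflations _ (x ∷ []) _ x∈ =
    0 ∷ [] , (x ∷ []) ∷ [] , Av213-1⊕ Av213-[] , refl , AvS-singleton x∈ ∷ [] , sym (inflate-singleton (x ∷ []))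
  AvS⊆Inflations (suc n) (x ∷ y ∷ rest) |π|≤ π∈ = decomposable⇒Inflations n (s≤s (s≤s z≤n)) |π|≤ π∈

  decomposable⇒Inflations n 2≤|π| |π|≤ π∈ with Separable⇒decomposable (proj₁ π∈) 2≤|π|
  ... | α , β , α↭ , β↭ , neα , neβ , inj₁ refl
    with summands-shorter neα neβ (subst (_≤ suc n) (length-⊕ α β) |π|≤) | AvS-⊕⁻ α↭ β↭ neβ π∈
  ...   | _ , |β|≤n | α∈ , β∈ = Inflations-1⊕ α∈ (AvS⊆Inflations n β |β|≤n β∈)
  decomposable⇒Inflations n _ |π|≤ π∈ | α , β , α↭ , β↭ , neα , neβ , inj₂ refl
    with summands-shorter neα neβ (subst (_≤ suc n) (length-⊖ α β) |π|≤) | AvS-⊖⁻ α↭ β↭ π∈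
  ...   | |α|≤n , |β|≤n | α∈ , β∈ = Inflations-⊖ (AvS⊆Inflations n α |α|≤n α∈) (AvS⊆Inflations n β |β|≤n β∈)

mainTheorem12 : (F : List ℕ → Set) →
    (∀ σ → F σ → Separable σ × SkewDecomposable σ) →
    ∀ π → (Inflations Av213 (AvS F) π → AvS (F ⊕1) π) × (AvS (F ⊕1) π → Inflations Av213 (AvS F) π)
mainTheorem12 F hF π = inflations⇒AvS , AvS⊆Inflations F F-skew (length π) π ≤-refl
  where
  F-skew : ∀ {g} → F g → SkewDecomposable g
  F-skew Fg = proj₂ (hF _ Fg)
  inflations⇒AvS : Inflations Av213 (AvS F) π → AvS (F ⊕1) π
  inflations⇒AvS (σ , τs , σ∈ , len , τs∈ , π≡) =
    subst (AvS (F ⊕1)) (sym π≡) (inflate-AvS F F-skew (length σ) σ τs ≤-refl σ∈ len τs∈)
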